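{- Let $m,n\geq1$ be integers and $\mathbf r=(r_1,\dots,r_m)$ a sequence of nonnegative integers with $|\mathbf r|=r_1+\cdots+r_m>0$, and let $c_k^{(\mathbf r)}$ ($1\le k\le n$) be the rational numbers defined below. Then for every $1\le k\le n$, $$\frac{c_k^{(\mathbf r)}}{|\mathbf r|}=[x_1^{r_1}\cdots x_m^{r_m}]\;\frac1k\left(\frac{1}{(1-x_1)\cdots(1-x_m)}-1\right)^k .$$ In particular $k\,c_k^{(\mathbf r)}/|\mathbf r|$ is a nonnegative integer and does not depend on $n$.
   Context: For a partition $\mu=(\mu_1\geq\cdots\geq\mu_l>0)$ of $n=|\mu|$, $l(\mu)=l$ is its length, $m_i(\mu)$ the multiplicity of the part $i$, and $z_\mu=\prod_{i\ge1}i^{m_i(\mu)}m_i(\mu)!$. The rising factorial is $(x)_s=x(x+1)\cdots(x+s-1)$, with $(x)_0=1$. Since the polynomials $\binom{X+n-1}{n-k}$, $1\le k\le n$, form a basis of the polynomials in $X$ of degree at most $n-1$, there exist unique rational numbers $c_k^{(\mathbf r)}$ ($1\le k\le n$, a priori depending on $n$) such that $$\sum_{|\mu|=n}\frac{X^{l(\mu)-1}}{z_\mu}\left(\sum_{i=1}^{l(\mu)}\prod_{k=1}^m\frac{(\mu_i)_{r_k}}{r_k!}\right)=\frac{1}{|\mathbf r|}\sum_{k=1}^{n}c_k^{(\mathbf r)}\binom{X+n-1}{n-k},$$ the sum being over all partitions $\mu$ of $n$. For a formal power series $f$, $[x_1^{r_1}\cdots x_m^{r_m}]f$ denotes the coefficient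 of $x_1^{r_1}\cdots x_m^{r_m}$ in $f$. -}

module Defs where

open import Data.Nat as ℕ using (ℕ; zero; suc; _∸_; _⊓_)

open import Data.Integer using (ℤ; +_)
open import Data.Rational as ℚ using (ℚ; 0ℚ; 1ℚ; _+_; _*_; _-_; _/_)
open import Data.List as L using (List; []; _∷_; map; concatMap; length; foldr)
open import Data.Vec as V using (Vec; []; _∷_)
open import Data.Fin using (Fin)
import Data.Nat.ListAction as LA
open import Data.Bool using (if_then_else_)

⟦_⟧ : ℕ → ℚ
⟦ n ⟧ = + n / 1

-- reciprocal of a natural number (only used for nonzero arguments)
recip : ℕ → ℚ
recip zero    = 0ℚ
recip (suc d) = + 1 / suc d

_^ℚ_ : ℚ → ℕ → ℚ
x ^ℚ zero  = 1ℚ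
x ^ℚ suc k = x * (x ^ℚ k)

Σℚ : List ℚ → ℚ
Σℚ = foldr _+_ 0ℚ

Πℚ : List ℚ → ℚ
Πℚ = foldr _*_ 1ℚ

-- [a .. b] inclusive range of naturals (empty if a > b)
range : ℕ → ℕ → List ℕ
range a b = map (a ℕ.+_) (L.upTo (suc b ∸ a))

-- partitionsAux fuel n b : all nonincreasing lists of positive parts,
-- each ≤ b, summing to n (fuel ≥ n guarantees completeness)
partitionsAux : ℕ → ℕ → ℕ → List (List ℕ)
partitionsAux _          zero    b = [] ∷ []
partitionsAux zero       (suc _) b = []
partitionsAux (suc fuel) (suc n) b =
  concatMap (λ i → map (i ∷_) (partitionsAux fuel (suc n ∸ i) i)) (range 1 (b ⊓ suc n))

partitions : ℕ → List (List ℕ)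
partitions n = partitionsAux n n n

mult : ℕ → List ℕ → ℕ
mult i μ = length (L.filter (λ j → j ℕ.≟ i) μ)

-- z_μ = ∏_{i ≥ 1} i^{m_i(μ)} m_i(μ)!   (parts of μ are ≤ |μ|)
z : List ℕ → ℕ
z μ = LA.product (map (λ i → (i ℕ.^ mult i μ) ℕ.* (mult i μ ℕ.!)) (range 1 (LA.sum μ)))

rising : ℕ → ℕ → ℕ
rising x zero    = 1
rising x (suc s) = x ℕ.* rising (suc x) s

fallingℚ : ℚ → ℕ → ℚ
fallingℚ y zero    = 1ℚ
fallingℚ y (suc j) = y * fallingℚ (y - 1ℚ) j

binomℚ : ℚ → ℕ → ℚ
binomℚ y j = fallingℚ y j * recip (j ℕ.!)

lhsSum : ∀ {m} → Vec ℕ m → ℕ → ℚ → ℚ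
lhsSum r n X = Σℚ (map term (partitions n))
  where
  term : List ℕ → ℚ
  term μ = ((X ^ℚ (length μ ∸ 1)) * recip (z μ)) *
           Σℚ (map (λ μi → Πℚ (V.toList (V.map (λ rk → ⟦ rising μi rk ⟧ * recip (rk ℕ.!)) r))) μ)

rhsSum : ∀ {m} → Vec ℕ m → ℕ → (ℕ → ℚ) → ℚ → ℚ
rhsSum r n c X = recip (V.sum r) *
  Σℚ (map (λ k → c k * binomℚ ((X + ⟦ n ⟧) - 1ℚ) (n ∸ k)) (range 1 n))

-- c are the coefficients defined in the context (identity of polynomials in X,
-- equivalently identity for all rational X)
IsCoeffs : ∀ {m} → Vec ℕ m → ℕ → (ℕ → ℚ) → Set
IsCoeffs r n c = ∀ (X : ℚ) → lhsSum r n X ≡ rhsSum r n c X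
  where open import Relation.Binary.PropositionalEquality using (_≡_)

-- Formal power series in m variables with rational coefficients:
-- a series is its coefficient function on multi-indices (exponent vectors).

Series : ℕ → Set
Series m = Vec ℕ m → ℚ

box : ∀ {m} → Vec ℕ m → List (Vec ℕ m)
box []       = [] ∷ []
box (r ∷ rs) = concatMap (λ a → map (a ∷_) (box rs)) (L.upTo (suc r))

_⊕_ : ∀ {m} → Series m → Series m → Series m
(f ⊕ g) a = f a + g a

_⊖_ : ∀ {m} → Series m → Series m → Series m
(f ⊖ g) a = f a - g a

scale : ∀ {m} → ℚ → Series m → Series m
scale q f a = q * f a

_⊛_ : ∀ {m} → Series m → Series m → Series m
(f ⊛ g) a = Σℚ (map (λ b → f b * g (V.zipWith _∸_ a b)) (box a))

oneS : ∀ {m} → Series m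
oneS a = if V.sum a ℕ.≡ᵇ 0 then 1ℚ else 0ℚ

_^S_ : ∀ {m} → Series m → ℕ → Series m
f ^S zero  = oneS
f ^S suc k = f ⊛ (f ^S k)

-- 1/(1 - x_i) = Σ_{j ≥ 0} x_i^j : coefficient 1 exactly on multi-indices
-- supported in coordinate i
geom : ∀ {m} → Fin m → Series m
geom i a = if V.sum a ℕ.≡ᵇ V.lookup a i then 1ℚ else 0ℚ

invProd : (m : ℕ) → Series m
invProd m = L.foldr _⊛_ oneS (map geom (L.allFin m))

targetSeries : (m k : ℕ) → Series m
targetSeries m k = scale (recip k) ((invProd m ⊖ oneS) ^S k)

{-# OPTIONS --safe #-}
-- Write P = ∏ᵢ 1/(1 - xᵢ) and φ(j) = ∏ₖ (j)_{rₖ}/rₖ!, the coefficient of x^r in P^j. Grouping the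
-- parts of a partition by size, z_μ factorises over the blocks of equal parts, and marking one
-- part of μ gives
--   Σ_{|μ|=n} X^{l(μ)-1}/z_μ · Σᵢ φ(μᵢ) = Σ_{j=1}^{n} φ(j)/j · W_{n-j},   W_s = Σ_{|μ|=s} X^{l(μ)}/z_μ.
-- For φ(j) = j this reads n·W_n = X·Σ_{s<n} W_s, so W_s = X(X+1)⋯(X+s-1)/s!. Expanding
-- P^j = (1 + (P - 1))^j gives φ(j)/j = Σᵢ C(j-1,i-1)·qᵢ/i with qᵢ = [x^r](P - 1)^i (q₀ = 0 as
-- |r| > 0), and Σⱼ C(j-1,i-1)·W_{n-j} = C(X+n-1, n-i). So the left-hand side is
-- Σᵢ (qᵢ/i)·C(X+n-1, n-i); these binomials are triangular at the integers X = s+1-n, hence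
-- c_k/|r| = q_k/k, and q_k ∈ ℕ because P - 1 has coefficients 0 and 1.
module Submission where

open import Defs
open import Data.Nat as ℕ using (ℕ; zero; suc; _∸_; _⊓_; _≤_; _<_; z≤n; s≤s)
import Data.Nat.Properties as ℕP
import Data.Nat.ListAction as ℕL
import Data.Nat.ListAction.Properties as ℕLP
open import Data.Nat.Combinatorics using (_C_; nC1≡n; nCk+nC[k+1]≡[n+1]C[k+1]; k>n⇒nCk≡0)
open import Data.Nat.Induction using (<-rec)
import Data.Nat.Coprimality as Coprime
import Data.Integer as ℤ
import Data.Integer.Properties as ℤP
open import Data.Rational as ℚ using (ℚ; 0ℚ; 1ℚ; _+_; _*_; _-_; mkℚ)
import Data.Rational.Properties as ℚP
open import Data.List as L using (List; []; _∷_; _++_; map; concatMap; length; replicate)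
import Data.List.Properties as LP
open import Data.List.Relation.Unary.All as All using (All; []; _∷_)
import Data.List.Relation.Unary.All.Properties as AllP
open import Data.Vec as V using (Vec; []; _∷_; sum)
open import Data.Fin as F using (Fin)
open import Data.Bool using (true; false; T; if_then_else_)
open import Data.Product using (_×_; _,_; ∃; proj₁; proj₂)
open import Function using (_∘_)
open import Relation.Nullary using (¬_; Dec; yes; no; contradiction)
open import Relation.Nullary.Decidable using (dec⇒maybe)
open import Relation.Binary.PropositionalEquality
open import Algebra.Properties.Group ℚP.+-0-group using () renaming (∙-cancelˡ to +-cancelˡ)
open import Tactic.RingSolver using (solve-∀)
import Tactic.RingSolver.Core.AlmostCommutativeRing as ACR
open import Data.Nat.Tactic.RingSolver using () renaming (solve-∀ to ℕ-solve-∀)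
open import Algebra.Bundles using (CommutativeMonoid)
import Algebra.Properties.CommutativeSemigroup as CommSemigroupProperties

open ≡-Reasoning

module ℚ+ = CommSemigroupProperties (CommutativeMonoid.commutativeSemigroup ℚP.+-0-commutativeMonoid)
module ℚ* = CommSemigroupProperties (CommutativeMonoid.commutativeSemigroup ℚP.*-1-commutativeMonoid)

ℚ-ring : ACR.AlmostCommutativeRing _ _
ℚ-ring = ACR.fromCommutativeRing ℚP.+-*-commutativeRing (λ x → dec⇒maybe (0ℚ ℚP.≟ x))

⟦⟧≡mkℚ : ∀ n → ⟦ n ⟧ ≡ mkℚ (ℤ.+ n) 0 (Coprime.sym (Coprime.1-coprimeTo n))
⟦⟧≡mkℚ n = ℚP.↥p/↧p≡p _

⟦⟧-homo-+ : ∀ a b → ⟦ a ℕ.+ b ⟧ ≡ ⟦ a ⟧ + ⟦ b ⟧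
⟦⟧-homo-+ a b = begin
  ⟦ a ℕ.+ b ⟧
    ≡⟨ ℚP./-cong (cong₂ ℤ._+_ (ℤP.*-identityʳ (ℤ.+ a)) (ℤP.*-identityʳ (ℤ.+ b))) refl ⟨
  ((ℤ.+ a) ℤ.* (ℤ.+ 1) ℤ.+ (ℤ.+ b) ℤ.* (ℤ.+ 1)) ℚ./ 1
    ≡⟨ cong₂ _+_ (⟦⟧≡mkℚ a) (⟦⟧≡mkℚ b) ⟨
  ⟦ a ⟧ + ⟦ b ⟧ ∎

⟦⟧-homo-* : ∀ a b → ⟦ a ℕ.* b ⟧ ≡ ⟦ a ⟧ * ⟦ b ⟧
⟦⟧-homo-* a b = begin
  ⟦ a ℕ.* b ⟧                 ≡⟨ ℚP./-cong (ℤP.pos-* a b) refl ⟩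
  ((ℤ.+ a) ℤ.* (ℤ.+ b)) ℚ./ 1 ≡⟨ cong₂ _*_ (⟦⟧≡mkℚ a) (⟦⟧≡mkℚ b) ⟨
  ⟦ a ⟧ * ⟦ b ⟧               ∎

⟦⟧-suc : ∀ a → ⟦ suc a ⟧ ≡ 1ℚ + ⟦ a ⟧
⟦⟧-suc = ⟦⟧-homo-+ 1

⟦⟧*recip : ∀ n .{{_ : ℕ.NonZero n}} → ⟦ n ⟧ * recip n ≡ 1ℚ
⟦⟧*recip (suc n) = begin
  ⟦ suc n ⟧ * recip (suc n) ≡⟨ cong₂ _*_ (⟦⟧≡mkℚ (suc n)) (ℚP.↥p/↧p≡p 1/n) ⟩
  n/1 * 1/n                 ≡⟨ ℚP.*-inverseʳ n/1 ⟩
  1ℚ                        ∎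
  where
  n/1 = mkℚ (ℤ.+ suc n) 0 (Coprime.sym (Coprime.1-coprimeTo (suc n)))
  1/n = mkℚ (ℤ.+ 1) n (Coprime.1-coprimeTo (suc n))

recip-unique : ∀ n .{{_ : ℕ.NonZero n}} {y} → ⟦ n ⟧ * y ≡ 1ℚ → y ≡ recip n
recip-unique n {y} ny≡1 = begin
  y                     ≡⟨ ℚP.*-identityˡ y ⟨
  1ℚ * y                ≡⟨ cong (_* y) (trans (ℚP.*-comm (recip n) ⟦ n ⟧) (⟦⟧*recip n)) ⟨
  (recip n * ⟦ n ⟧) * y ≡⟨ ℚP.*-assoc (recip n) ⟦ n ⟧ y ⟩
  recip n * (⟦ n ⟧ * y) ≡⟨ cong (recip n *_) ny≡1 ⟩
  recip n * 1ℚ          ≡⟨ ℚP.*-identityʳ (recip n) ⟩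
  recip n               ∎

recip-cancelˡ : ∀ n .{{_ : ℕ.NonZero n}} x → recip n * (⟦ n ⟧ * x) ≡ x
recip-cancelˡ n x = begin
  recip n * (⟦ n ⟧ * x) ≡⟨ ℚP.*-assoc (recip n) ⟦ n ⟧ x ⟨
  (recip n * ⟦ n ⟧) * x ≡⟨ cong (_* x) (trans (ℚP.*-comm (recip n) ⟦ n ⟧) (⟦⟧*recip n)) ⟩
  1ℚ * x                ≡⟨ ℚP.*-identityˡ x ⟩
  x                     ∎

⟦⟧*-cancelˡ : ∀ n .{{_ : ℕ.NonZero n}} {x y} → ⟦ n ⟧ * x ≡ ⟦ n ⟧ * y → x ≡ y
⟦⟧*-cancelˡ n {x} {y} nx≡ny = begin
  x                     ≡⟨ recip-cancelˡ n x ⟨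
  recip n * (⟦ n ⟧ * x) ≡⟨ cong (recip n *_) nx≡ny ⟩
  recip n * (⟦ n ⟧ * y) ≡⟨ recip-cancelˡ n y ⟩
  y                     ∎

recip-* : ∀ a b → recip (a ℕ.* b) ≡ recip a * recip b
recip-* zero      b         = sym (ℚP.*-zeroˡ (recip b))
recip-* (suc a)   zero      = trans (cong recip (ℕP.*-zeroʳ (suc a))) (sym (ℚP.*-zeroʳ (recip (suc a))))
recip-* a@(suc _) b@(suc _) = sym (recip-unique (a ℕ.* b) (begin
  ⟦ a ℕ.* b ⟧ * (recip a * recip b)     ≡⟨ cong (_* (recip a * recip b)) (⟦⟧-homo-* a b) ⟩
  (⟦ a ⟧ * ⟦ b ⟧) * (recip a * recip b) ≡⟨ ℚ*.interchange ⟦ a ⟧ ⟦ b ⟧ (recip a) (recip b) ⟩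
  (⟦ a ⟧ * recip a) * (⟦ b ⟧ * recip b) ≡⟨ cong₂ _*_ (⟦⟧*recip a) (⟦⟧*recip b) ⟩
  1ℚ                                    ∎))

-- Finite sums

∑< : ℕ → (ℕ → ℚ) → ℚ
∑< zero    f = 0ℚ
∑< (suc n) f = ∑< n f + f n

syntax ∑< n (λ i → e) = ∑[ i < n ] e

∑-cong : ∀ n {f g : ℕ → ℚ} → (∀ i → i < n → f i ≡ g i) → ∑< n f ≡ ∑< n g
∑-cong zero    f≡g = refl
∑-cong (suc n) f≡g = cong₂ _+_ (∑-cong n (λ i i<n → f≡g i (ℕP.m<n⇒m<1+n i<n))) (f≡g n ℕP.≤-refl)

∑-head : ∀ n (f : ℕ → ℚ) → ∑< (suc n) f ≡ f 0 + ∑[ i < n ] f (suc i)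
∑-head zero    f = trans (ℚP.+-identityˡ (f 0)) (sym (ℚP.+-identityʳ (f 0)))
∑-head (suc n) f = begin
  ∑< (suc n) f + f (suc n)                 ≡⟨ cong (_+ f (suc n)) (∑-head n f) ⟩
  (f 0 + ∑[ i < n ] f (suc i)) + f (suc n) ≡⟨ ℚP.+-assoc (f 0) _ _ ⟩
  f 0 + ∑[ i < suc n ] f (suc i)           ∎

∑-zero : ∀ n {f : ℕ → ℚ} → (∀ i → i < n → f i ≡ 0ℚ) → ∑< n f ≡ 0ℚ
∑-zero zero    f≡0 = refl
∑-zero (suc n) f≡0 = begin
  ∑< n _ + _ ≡⟨ cong₂ _+_ (∑-zero n (λ i i<n → f≡0 i (ℕP.m<n⇒m<1+n i<n))) (f≡0 n ℕP.≤-refl) ⟩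
  0ℚ + 0ℚ    ≡⟨ ℚP.+-identityʳ 0ℚ ⟩
  0ℚ         ∎

∑-distrib-+ : ∀ n (f g : ℕ → ℚ) → ∑[ i < n ] (f i + g i) ≡ ∑< n f + ∑< n g
∑-distrib-+ zero    f g = refl
∑-distrib-+ (suc n) f g = begin
  ∑[ i < n ] (f i + g i) + (f n + g n) ≡⟨ cong (_+ (f n + g n)) (∑-distrib-+ n f g) ⟩
  (∑< n f + ∑< n g) + (f n + g n)      ≡⟨ ℚ+.interchange (∑< n f) (∑< n g) (f n) (g n) ⟩
  ∑< (suc n) f + ∑< (suc n) g          ∎

∑-distribˡ : ∀ n c (f : ℕ → ℚ) → c * ∑< n f ≡ ∑[ i < n ] (c * f i)
∑-distribˡ zero    c f = ℚP.*-zeroʳ c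
∑-distribˡ (suc n) c f = trans (ℚP.*-distribˡ-+ c (∑< n f) (f n)) (cong (_+ c * f n) (∑-distribˡ n c f))

∑-distribʳ : ∀ n c (f : ℕ → ℚ) → ∑< n f * c ≡ ∑[ i < n ] (f i * c)
∑-distribʳ n c f = begin
  ∑< n f * c           ≡⟨ ℚP.*-comm (∑< n f) c ⟩
  c * ∑< n f           ≡⟨ ∑-distribˡ n c f ⟩
  ∑[ i < n ] (c * f i) ≡⟨ ∑-cong n (λ i _ → ℚP.*-comm c (f i)) ⟩
  ∑[ i < n ] (f i * c) ∎

∑-truncate : ∀ {k n} (f : ℕ → ℚ) → k ≤ n → (∀ i → k ≤ i → f i ≡ 0ℚ) → ∑< n f ≡ ∑< k f
∑-truncate {k} {n} f k≤n f≡0 = begin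
  ∑< n f               ≡⟨ cong (λ t → ∑< t f) (ℕP.m+[n∸m]≡n k≤n) ⟨
  ∑< (k ℕ.+ (n ∸ k)) f ≡⟨ extra (n ∸ k) ⟩
  ∑< k f               ∎
  where
  extra : ∀ d → ∑< (k ℕ.+ d) f ≡ ∑< k f
  extra zero    = cong (λ t → ∑< t f) (ℕP.+-identityʳ k)
  extra (suc d) = begin
    ∑< (k ℕ.+ suc d) f           ≡⟨ cong (λ t → ∑< t f) (ℕP.+-suc k d) ⟩
    ∑< (k ℕ.+ d) f + f (k ℕ.+ d) ≡⟨ cong₂ _+_ (extra d) (f≡0 (k ℕ.+ d) (ℕP.m≤m+n k d)) ⟩
    ∑< k f + 0ℚ                  ≡⟨ ℚP.+-identityʳ (∑< k f) ⟩
    ∑< k f                       ∎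

∑-comm : ∀ m n (f : ℕ → ℕ → ℚ) → ∑[ i < m ] ∑< n (f i) ≡ ∑[ j < n ] ∑[ i < m ] f i j
∑-comm zero    n f = sym (∑-zero n (λ _ _ → refl))
∑-comm (suc m) n f = begin
  ∑[ i < m ] ∑< n (f i) + ∑< n (f m)       ≡⟨ cong (_+ ∑< n (f m)) (∑-comm m n f) ⟩
  ∑[ j < n ] ∑[ i < m ] f i j + ∑< n (f m) ≡⟨ ∑-distrib-+ n _ (f m) ⟨
  ∑[ j < n ] ∑[ i < suc m ] f i j          ∎

∑-reverse : ∀ n (f : ℕ → ℚ) → ∑< n f ≡ ∑[ i < n ] f (n ∸ suc i)
∑-reverse zero    f = refl
∑-reverse (suc n) f = begin
  ∑< n f + f n                     ≡⟨ ℚP.+-comm (∑< n f) (f n) ⟩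
  f n + ∑< n f                     ≡⟨ cong (f n +_) (∑-reverse n f) ⟩
  f n + ∑[ i < n ] f (n ∸ suc i)   ≡⟨ ∑-head n (λ i → f (suc n ∸ suc i)) ⟨
  ∑[ i < suc n ] f (suc n ∸ suc i) ∎

Σℚ-++ : ∀ xs ys → Σℚ (xs ++ ys) ≡ Σℚ xs + Σℚ ys
Σℚ-++ []       ys = sym (ℚP.+-identityˡ (Σℚ ys))
Σℚ-++ (x ∷ xs) ys = trans (cong (x +_) (Σℚ-++ xs ys)) (sym (ℚP.+-assoc x (Σℚ xs) (Σℚ ys)))

Σℚ-concatMap : ∀ {A B : Set} (f : B → ℚ) (g : A → List B) xs →
  Σℚ (map f (concatMap g xs)) ≡ Σℚ (map (λ x → Σℚ (map f (g x))) xs)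
Σℚ-concatMap f g []       = refl
Σℚ-concatMap f g (x ∷ xs) = begin
  Σℚ (map f (g x ++ concatMap g xs))             ≡⟨ cong Σℚ (LP.map-++ f (g x) (concatMap g xs)) ⟩
  Σℚ (map f (g x) ++ map f (concatMap g xs))     ≡⟨ Σℚ-++ (map f (g x)) _ ⟩
  Σℚ (map f (g x)) + Σℚ (map f (concatMap g xs)) ≡⟨ cong (Σℚ (map f (g x)) +_) (Σℚ-concatMap f g xs) ⟩
  Σℚ (map (λ x → Σℚ (map f (g x))) (x ∷ xs))     ∎

Σℚ-cong : ∀ {A : Set} {f g : A → ℚ} xs → (∀ x → f x ≡ g x) → Σℚ (map f xs) ≡ Σℚ (map g xs)
Σℚ-cong xs f≡g = cong Σℚ (LP.map-cong f≡g xs)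

Σℚ-zero : ∀ {A : Set} {f : A → ℚ} xs → (∀ x → f x ≡ 0ℚ) → Σℚ (map f xs) ≡ 0ℚ
Σℚ-zero []       f≡0 = refl
Σℚ-zero (x ∷ xs) f≡0 = trans (cong₂ _+_ (f≡0 x) (Σℚ-zero xs f≡0)) (ℚP.+-identityʳ 0ℚ)

Σℚ-distribˡ : ∀ {A : Set} c (f : A → ℚ) xs → c * Σℚ (map f xs) ≡ Σℚ (map (λ x → c * f x) xs)
Σℚ-distribˡ c f []       = ℚP.*-zeroʳ c
Σℚ-distribˡ c f (x ∷ xs) = trans (ℚP.*-distribˡ-+ c (f x) _) (cong (c * f x +_) (Σℚ-distribˡ c f xs))

Σℚ-distrib-+ : ∀ {A : Set} (f g : A → ℚ) xs →
  Σℚ (map (λ x → f x + g x) xs) ≡ Σℚ (map f xs) + Σℚ (map g xs)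
Σℚ-distrib-+ f g []       = sym (ℚP.+-identityʳ 0ℚ)
Σℚ-distrib-+ f g (x ∷ xs) = begin
  (f x + g x) + Σℚ (map (λ x → f x + g x) xs)   ≡⟨ cong ((f x + g x) +_) (Σℚ-distrib-+ f g xs) ⟩
  (f x + g x) + (Σℚ (map f xs) + Σℚ (map g xs)) ≡⟨ ℚ+.interchange (f x) (g x) _ _ ⟩
  Σℚ (map f (x ∷ xs)) + Σℚ (map g (x ∷ xs))     ∎

Σℚ-∑ : ∀ {A : Set} n (f : ℕ → A → ℚ) xs →
  Σℚ (map (λ x → ∑[ i < n ] f i x) xs) ≡ ∑[ i < n ] Σℚ (map (f i) xs)
Σℚ-∑ zero    f xs = Σℚ-zero xs (λ _ → refl)
Σℚ-∑ (suc n) f xs = begin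
  Σℚ (map (λ x → ∑[ i < n ] f i x + f n x) xs)             ≡⟨ Σℚ-distrib-+ _ (f n) xs ⟩
  Σℚ (map (λ x → ∑[ i < n ] f i x) xs) + Σℚ (map (f n) xs) ≡⟨ cong (_+ Σℚ (map (f n) xs)) (Σℚ-∑ n f xs) ⟩
  ∑[ i < suc n ] Σℚ (map (f i) xs)                         ∎

Σℚ-applyUpTo : ∀ (f : ℕ → ℚ) g n → Σℚ (map f (L.applyUpTo g n)) ≡ ∑[ i < n ] f (g i)
Σℚ-applyUpTo f g zero    = refl
Σℚ-applyUpTo f g (suc n) = begin
  f (g 0) + Σℚ (map f (L.applyUpTo (g ∘ suc) n)) ≡⟨ cong (f (g 0) +_) (Σℚ-applyUpTo f (g ∘ suc) n) ⟩
  f (g 0) + ∑[ i < n ] f (g (suc i))             ≡⟨ ∑-head n (f ∘ g) ⟨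
  ∑[ i < suc n ] f (g i)                         ∎

Σℚ-upTo : ∀ (f : ℕ → ℚ) n → Σℚ (map f (L.upTo n)) ≡ ∑< n f
Σℚ-upTo f = Σℚ-applyUpTo f (λ i → i)

Σℚ-range1 : ∀ (f : ℕ → ℚ) n → Σℚ (map f (range 1 n)) ≡ ∑[ i < n ] f (suc i)
Σℚ-range1 f n = trans (cong Σℚ (sym (LP.map-∘ (L.upTo n)))) (Σℚ-upTo (f ∘ suc) n)

-- Switches off the terms of a sum in which k ∸ i truncates.
guard : ℕ → ℕ → ℚ → ℚ
guard i k x with i ℕ.≤? k
... | yes _ = x
... | no  _ = 0ℚ

guard-yes : ∀ {i k} x → i ≤ k → guard i k x ≡ x
guard-yes {i} {k} x i≤k with i ℕ.≤? k
... | yes _   = refl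
... | no  i≰k = contradiction i≤k i≰k

guard-no : ∀ {i k} x → ¬ i ≤ k → guard i k x ≡ 0ℚ
guard-no {i} {k} x i≰k with i ℕ.≤? k
... | yes i≤k = contradiction i≤k i≰k
... | no  _   = refl

guard-cong-≤ : ∀ {i k i′ k′} x → (i ≤ k → i′ ≤ k′) → (i′ ≤ k′ → i ≤ k) →
  guard i k x ≡ guard i′ k′ x
guard-cong-≤ {i} {k} {i′} {k′} x to from = by-cases (i ℕ.≤? k)
  where
  by-cases : Dec (i ≤ k) → guard i k x ≡ guard i′ k′ x
  by-cases (yes i≤k) = trans (guard-yes x i≤k) (sym (guard-yes x (to i≤k)))
  by-cases (no  i≰k) = trans (guard-no x i≰k) (sym (guard-no x (i≰k ∘ from)))

guard-+ : ∀ i k x y → guard i k (x + y) ≡ guard i k x + guard i k y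
guard-+ i k x y with i ℕ.≤? k
... | yes _ = refl
... | no  _ = sym (ℚP.+-identityʳ 0ℚ)

guard-* : ∀ i k c x → guard i k (c * x) ≡ c * guard i k x
guard-* i k c x with i ℕ.≤? k
... | yes _ = refl
... | no  _ = sym (ℚP.*-zeroʳ c)

guard-∑ : ∀ i k n (f : ℕ → ℚ) → guard i k (∑< n f) ≡ ∑[ j < n ] guard i k (f j)
guard-∑ i k zero    f with i ℕ.≤? k
... | yes _ = refl
... | no  _ = refl
guard-∑ i k (suc n) f = trans (guard-+ i k (∑< n f) (f n)) (cong (_+ guard i k (f n)) (guard-∑ i k n f))

guard-shift : ∀ a c N x → a ≤ N → guard (a ℕ.+ c) N x ≡ guard c (N ∸ a) x
guard-shift a c N x a≤N = guard-cong-≤ x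
  (λ a+c≤N → subst (_≤ N ∸ a) (ℕP.m+n∸m≡n a c) (ℕP.∸-monoˡ-≤ a a+c≤N))
  (λ c≤N∸a → subst (a ℕ.+ c ≤_) (ℕP.m+[n∸m]≡n a≤N) (ℕP.+-monoʳ-≤ a c≤N∸a))

guard-guard : ∀ a c N x → guard a N (guard c (N ∸ a) x) ≡ guard (a ℕ.+ c) N x
guard-guard a c N x = by-cases (a ℕ.≤? N)
  where
  by-cases : Dec (a ≤ N) → guard a N (guard c (N ∸ a) x) ≡ guard (a ℕ.+ c) N x
  by-cases (yes a≤N) = trans (guard-yes _ a≤N) (sym (guard-shift a c N x a≤N))
  by-cases (no  a≰N) = trans (guard-no _ a≰N) (sym (guard-no x (a≰N ∘ ℕP.m+n≤o⇒m≤o a)))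

-- Binomial coefficients and multisets

C-absorb : ∀ n k → suc k ℕ.* (suc n C suc k) ≡ suc n ℕ.* (n C k)
C-absorb zero    zero    = refl
C-absorb zero    (suc k) = ℕP.*-zeroʳ (suc (suc k))
C-absorb (suc n) zero    = trans (ℕP.*-identityˡ _) (trans (nC1≡n (suc (suc n))) (sym (ℕP.*-identityʳ _)))
C-absorb (suc n) (suc k) = begin
  suc (suc k) ℕ.* (suc (suc n) C suc (suc k))
    ≡⟨ cong (suc (suc k) ℕ.*_) (nCk+nC[k+1]≡[n+1]C[k+1] (suc n) (suc k)) ⟨
  suc (suc k) ℕ.* (A ℕ.+ B)
    ≡⟨ regroup (suc k) A B ⟩
  A ℕ.+ (suc k ℕ.* A ℕ.+ suc (suc k) ℕ.* B)
    ≡⟨ cong₂ (λ x y → A ℕ.+ (x ℕ.+ y)) (C-absorb n k) (C-absorb n (suc k)) ⟩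
  A ℕ.+ (suc n ℕ.* (n C k) ℕ.+ suc n ℕ.* (n C suc k))
    ≡⟨ cong (A ℕ.+_) (ℕP.*-distribˡ-+ (suc n) (n C k) (n C suc k)) ⟨
  A ℕ.+ suc n ℕ.* (n C k ℕ.+ n C suc k)
    ≡⟨ cong (λ t → A ℕ.+ suc n ℕ.* t) (nCk+nC[k+1]≡[n+1]C[k+1] n k) ⟩
  suc (suc n) ℕ.* A ∎
  where
  A = suc n C suc k
  B = suc n C suc (suc k)
  regroup : ∀ k a b → suc k ℕ.* (a ℕ.+ b) ≡ a ℕ.+ (k ℕ.* a ℕ.+ suc k ℕ.* b)
  regroup = ℕ-solve-∀

C-absorbℚ : ∀ j i → ⟦ suc j C suc i ⟧ * recip (suc j) ≡ ⟦ j C i ⟧ * recip (suc i)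
C-absorbℚ j i = begin
  ⟦ C′ ⟧ * recip (suc j)
    ≡⟨ cong (_* recip (suc j)) (recip-cancelˡ (suc i) ⟦ C′ ⟧) ⟨
  recip (suc i) * (⟦ suc i ⟧ * ⟦ C′ ⟧) * recip (suc j)
    ≡⟨ cong (λ t → recip (suc i) * t * recip (suc j)) absorb ⟩
  recip (suc i) * (⟦ suc j ⟧ * ⟦ j C i ⟧) * recip (suc j)
    ≡⟨ regroup (recip (suc i)) ⟦ suc j ⟧ ⟦ j C i ⟧ (recip (suc j)) ⟩
  (⟦ suc j ⟧ * recip (suc j)) * (⟦ j C i ⟧ * recip (suc i))
    ≡⟨ cong (_* (⟦ j C i ⟧ * recip (suc i))) (⟦⟧*recip (suc j)) ⟩
  1ℚ * (⟦ j C i ⟧ * recip (suc i))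
    ≡⟨ ℚP.*-identityˡ _ ⟩
  ⟦ j C i ⟧ * recip (suc i) ∎
  where
  C′ = suc j C suc i
  absorb : ⟦ suc i ⟧ * ⟦ C′ ⟧ ≡ ⟦ suc j ⟧ * ⟦ j C i ⟧
  absorb = trans (sym (⟦⟧-homo-* (suc i) C′)) (trans (cong ⟦_⟧ (C-absorb j i)) (⟦⟧-homo-* (suc j) (j C i)))
  regroup : ∀ r a c q → r * (a * c) * q ≡ (a * q) * (c * r)
  regroup = solve-∀ ℚ-ring

rising-suc : ∀ x s → rising x (suc s) ≡ rising x s ℕ.* (x ℕ.+ s)
rising-suc x zero    = trans (ℕP.*-identityʳ x) (trans (sym (ℕP.+-identityʳ x)) (sym (ℕP.*-identityˡ (x ℕ.+ 0))))
rising-suc x (suc s) = begin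
  x ℕ.* rising (suc x) (suc s)               ≡⟨ cong (x ℕ.*_) (rising-suc (suc x) s) ⟩
  x ℕ.* (rising (suc x) s ℕ.* (suc x ℕ.+ s)) ≡⟨ ℕP.*-assoc x _ _ ⟨
  x ℕ.* rising (suc x) s ℕ.* (suc x ℕ.+ s)   ≡⟨ cong (x ℕ.* rising (suc x) s ℕ.*_) (ℕP.+-suc x s) ⟨
  x ℕ.* rising (suc x) s ℕ.* (x ℕ.+ suc s)   ∎

multichoose : ℚ → ℕ → ℚ
multichoose y zero    = 1ℚ
multichoose y (suc s) = multichoose y s * (y + ⟦ s ⟧) * recip (suc s)

multichoose-shift : ∀ y u → y * multichoose (y + 1ℚ) u ≡ (y + ⟦ u ⟧) * multichoose y u
multichoose-shift y zero    = trans (ℚP.*-identityʳ y) (sym (trans (ℚP.*-identityʳ _) (ℚP.+-identityʳ y)))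
multichoose-shift y (suc u) = begin
  y * (multichoose (y + 1ℚ) u * (y + 1ℚ + ⟦ u ⟧) * r)
    ≡⟨ regroup₁ y (multichoose (y + 1ℚ) u) (y + 1ℚ + ⟦ u ⟧) r ⟩
  (y * multichoose (y + 1ℚ) u) * (y + 1ℚ + ⟦ u ⟧) * r
    ≡⟨ cong (λ t → t * (y + 1ℚ + ⟦ u ⟧) * r) (multichoose-shift y u) ⟩
  ((y + ⟦ u ⟧) * multichoose y u) * (y + 1ℚ + ⟦ u ⟧) * r
    ≡⟨ regroup₂ y ⟦ u ⟧ (multichoose y u) r ⟩
  (y + (1ℚ + ⟦ u ⟧)) * multichoose y (suc u)
    ≡⟨ cong (λ t → (y + t) * multichoose y (suc u)) (⟦⟧-suc u) ⟨
  (y + ⟦ suc u ⟧) * multichoose y (suc u) ∎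
  where
  r = recip (suc u)
  regroup₁ : ∀ y h z r → y * (h * z * r) ≡ (y * h) * z * r
  regroup₁ = solve-∀ ℚ-ring
  regroup₂ : ∀ y u h r → ((y + u) * h) * (y + 1ℚ + u) * r ≡ (y + (1ℚ + u)) * (h * (y + u) * r)
  regroup₂ = solve-∀ ℚ-ring

multichoose-pascal : ∀ y u → multichoose (y + 1ℚ) (suc u) ≡ multichoose (y + 1ℚ) u + multichoose y (suc u)
multichoose-pascal y u = begin
  h′ * (y + 1ℚ + ⟦ u ⟧) * r
    ≡⟨ split h′ y ⟦ u ⟧ r ⟩
  h′ * ((1ℚ + ⟦ u ⟧) * r) + (y * h′) * r
    ≡⟨ cong₂ (λ a b → h′ * (a * r) + b * r) (sym (⟦⟧-suc u)) (multichoose-shift y u) ⟩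
  h′ * (⟦ suc u ⟧ * r) + ((y + ⟦ u ⟧) * h) * r
    ≡⟨ cong (λ t → h′ * t + ((y + ⟦ u ⟧) * h) * r) (⟦⟧*recip (suc u)) ⟩
  h′ * 1ℚ + ((y + ⟦ u ⟧) * h) * r
    ≡⟨ regroup h′ y ⟦ u ⟧ h r ⟩
  h′ + h * (y + ⟦ u ⟧) * r ∎
  where
  h  = multichoose y u
  h′ = multichoose (y + 1ℚ) u
  r  = recip (suc u)
  split : ∀ h y u r → h * (y + 1ℚ + u) * r ≡ h * ((1ℚ + u) * r) + (y * h) * r
  split = solve-∀ ℚ-ring
  regroup : ∀ h′ y u h r → h′ * 1ℚ + ((y + u) * h) * r ≡ h′ + h * (y + u) * r
  regroup = solve-∀ ℚ-ring

multichoose≡binomℚ : ∀ y s → multichoose y s ≡ binomℚ ((y + ⟦ s ⟧) - 1ℚ) s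
multichoose≡binomℚ y zero    = refl
multichoose≡binomℚ y (suc s) = sym (begin
  fallingℚ ((y + ⟦ suc s ⟧) - 1ℚ) (suc s) * recip (suc s ℕ.* s ℕ.!)
    ≡⟨ cong₂ (λ a b → a * fallingℚ (a - 1ℚ) s * b) shift (recip-* (suc s) (s ℕ.!)) ⟩
  w * fallingℚ (w - 1ℚ) s * (recip (suc s) * recip (s ℕ.!))
    ≡⟨ regroup w (fallingℚ (w - 1ℚ) s) (recip (suc s)) (recip (s ℕ.!)) ⟩
  binomℚ (w - 1ℚ) s * w * recip (suc s)
    ≡⟨ cong (λ t → t * w * recip (suc s)) (multichoose≡binomℚ y s) ⟨
  multichoose y (suc s) ∎)
  where
  w = y + ⟦ s ⟧
  shift : (y + ⟦ suc s ⟧) - 1ℚ ≡ w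
  shift = trans (cong (λ t → (y + t) - 1ℚ) (⟦⟧-suc s)) (cancel y ⟦ s ⟧)
    where
    cancel : ∀ y s → (y + (1ℚ + s)) - 1ℚ ≡ y + s
    cancel = solve-∀ ℚ-ring
  regroup : ∀ z f r q → z * f * (r * q) ≡ f * q * z * r
  regroup = solve-∀ ℚ-ring

∑-multichoose : ∀ y a → ∑[ b < suc a ] multichoose y (a ∸ b) ≡ multichoose (y + 1ℚ) a
∑-multichoose y zero    = ℚP.+-identityˡ 1ℚ
∑-multichoose y (suc a) = begin
  ∑[ b < suc (suc a) ] multichoose y (suc a ∸ b)
    ≡⟨ ∑-head (suc a) (λ b → multichoose y (suc a ∸ b)) ⟩
  multichoose y (suc a) + ∑[ b < suc a ] multichoose y (a ∸ b)
    ≡⟨ cong (multichoose y (suc a) +_) (∑-multichoose y a) ⟩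
  multichoose y (suc a) + multichoose (y + 1ℚ) a
    ≡⟨ ℚP.+-comm (multichoose y (suc a)) _ ⟩
  multichoose (y + 1ℚ) a + multichoose y (suc a)
    ≡⟨ multichoose-pascal y a ⟨
  multichoose (y + 1ℚ) (suc a) ∎

multichoose-rec : ∀ x N → ⟦ N ⟧ * multichoose x N ≡ x * ∑< N (multichoose x)
multichoose-rec x zero    = trans (ℚP.*-zeroˡ 1ℚ) (sym (ℚP.*-zeroʳ x))
multichoose-rec x (suc N) = begin
  ⟦ suc N ⟧ * (h * (x + ⟦ N ⟧) * r)
    ≡⟨ regroup ⟦ suc N ⟧ h x ⟦ N ⟧ r ⟩
  (⟦ suc N ⟧ * r) * (⟦ N ⟧ * h + x * h)
    ≡⟨ cong₂ (λ a b → a * (b + x * h)) (⟦⟧*recip (suc N)) (multichoose-rec x N) ⟩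
  1ℚ * (x * ∑< N (multichoose x) + x * h)
    ≡⟨ ℚP.*-identityˡ _ ⟩
  x * ∑< N (multichoose x) + x * h
    ≡⟨ ℚP.*-distribˡ-+ x _ h ⟨
  x * ∑< (suc N) (multichoose x) ∎
  where
  h = multichoose x N
  r = recip (suc N)
  regroup : ∀ a h x n r → a * (h * (x + n) * r) ≡ (a * r) * (n * h + x * h)
  regroup = solve-∀ ℚ-ring

rising≡multichoose : ∀ j c → ⟦ rising j c ⟧ * recip (c ℕ.!) ≡ multichoose ⟦ j ⟧ c
rising≡multichoose j zero    = ⟦⟧*recip 1
rising≡multichoose j (suc c) = begin
  ⟦ rising j (suc c) ⟧ * recip (suc c ℕ.* c ℕ.!)
    ≡⟨ cong₂ _*_ ⟦rising⟧ (recip-* (suc c) (c ℕ.!)) ⟩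
  ⟦ rising j c ⟧ * (⟦ j ⟧ + ⟦ c ⟧) * (recip (suc c) * recip (c ℕ.!))
    ≡⟨ regroup ⟦ rising j c ⟧ (⟦ j ⟧ + ⟦ c ⟧) (recip (suc c)) (recip (c ℕ.!)) ⟩
  ⟦ rising j c ⟧ * recip (c ℕ.!) * (⟦ j ⟧ + ⟦ c ⟧) * recip (suc c)
    ≡⟨ cong (λ t → t * (⟦ j ⟧ + ⟦ c ⟧) * recip (suc c)) (rising≡multichoose j c) ⟩
  multichoose ⟦ j ⟧ (suc c) ∎
  where
  ⟦rising⟧ : ⟦ rising j (suc c) ⟧ ≡ ⟦ rising j c ⟧ * (⟦ j ⟧ + ⟦ c ⟧)
  ⟦rising⟧ = begin
    ⟦ rising j (suc c) ⟧             ≡⟨ cong ⟦_⟧ (rising-suc j c) ⟩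
    ⟦ rising j c ℕ.* (j ℕ.+ c) ⟧     ≡⟨ ⟦⟧-homo-* (rising j c) (j ℕ.+ c) ⟩
    ⟦ rising j c ⟧ * ⟦ j ℕ.+ c ⟧     ≡⟨ cong (⟦ rising j c ⟧ *_) (⟦⟧-homo-+ j c) ⟩
    ⟦ rising j c ⟧ * (⟦ j ⟧ + ⟦ c ⟧) ∎
  regroup : ∀ a b r q → a * b * (r * q) ≡ a * q * b * r
  regroup = solve-∀ ℚ-ring

C-sum : ℚ → ℕ → ℕ → ℚ
C-sum y i k = ∑[ j < suc k ] (⟦ j C i ⟧ * multichoose y (k ∸ j))

C-sum-pascal : ∀ y i k → C-sum y (suc i) (suc k) ≡ C-sum y i k + C-sum y (suc i) k
C-sum-pascal y i k = begin
  C-sum y (suc i) (suc k)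
    ≡⟨ ∑-head (suc k) _ ⟩
  ⟦ 0 ⟧ * multichoose y (suc k) + ∑[ j < suc k ] f (suc j)
    ≡⟨ cong (_+ ∑< (suc k) (f ∘ suc)) (ℚP.*-zeroˡ (multichoose y (suc k))) ⟩
  0ℚ + ∑[ j < suc k ] f (suc j)
    ≡⟨ ℚP.+-identityˡ _ ⟩
  ∑[ j < suc k ] f (suc j)
    ≡⟨ ∑-cong (suc k) (λ j _ → pascal j) ⟩
  ∑[ j < suc k ] (⟦ j C i ⟧ * h j + ⟦ j C suc i ⟧ * h j)
    ≡⟨ ∑-distrib-+ (suc k) _ _ ⟩
  C-sum y i k + C-sum y (suc i) k ∎
  where
  h : ℕ → ℚ
  h j = multichoose y (k ∸ j)
  f : ℕ → ℚ
  f j = ⟦ j C suc i ⟧ * multichoose y (suc k ∸ j)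
  pascal : ∀ j → f (suc j) ≡ ⟦ j C i ⟧ * h j + ⟦ j C suc i ⟧ * h j
  pascal j = begin
    ⟦ suc j C suc i ⟧ * h j               ≡⟨ cong (λ t → ⟦ t ⟧ * h j) (nCk+nC[k+1]≡[n+1]C[k+1] j i) ⟨
    ⟦ j C i ℕ.+ j C suc i ⟧ * h j         ≡⟨ cong (_* h j) (⟦⟧-homo-+ (j C i) (j C suc i)) ⟩
    (⟦ j C i ⟧ + ⟦ j C suc i ⟧) * h j     ≡⟨ ℚP.*-distribʳ-+ (h j) ⟦ j C i ⟧ ⟦ j C suc i ⟧ ⟩
    ⟦ j C i ⟧ * h j + ⟦ j C suc i ⟧ * h j ∎

C-sum-vanish : ∀ y i → C-sum y (suc i) i ≡ 0ℚ
C-sum-vanish y i = ∑-zero (suc i) vanish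
  where
  vanish : ∀ j → j < suc i → ⟦ j C suc i ⟧ * multichoose y (i ∸ j) ≡ 0ℚ
  vanish j j≤i = begin
    ⟦ j C suc i ⟧ * multichoose y (i ∸ j)
      ≡⟨ cong (λ t → ⟦ t ⟧ * multichoose y (i ∸ j)) (k>n⇒nCk≡0 (s≤s (ℕP.≤-pred j≤i))) ⟩
    0ℚ * multichoose y (i ∸ j)
      ≡⟨ ℚP.*-zeroˡ (multichoose y (i ∸ j)) ⟩
    0ℚ ∎

C-sum≡multichoose : ∀ y i d → C-sum y i (i ℕ.+ d) ≡ multichoose (y + ⟦ suc i ⟧) d
C-sum≡multichoose y zero    d       = trans (∑-cong (suc d) (λ j _ → ℚP.*-identityˡ _)) (∑-multichoose y d)
C-sum≡multichoose y (suc i) zero    = begin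
  C-sum y (suc i) (suc i ℕ.+ 0)
    ≡⟨ cong (C-sum y (suc i)) (ℕP.+-identityʳ (suc i)) ⟩
  C-sum y (suc i) (suc i)
    ≡⟨ C-sum-pascal y i i ⟩
  C-sum y i i + C-sum y (suc i) i
    ≡⟨ cong₂ _+_ (trans (cong (C-sum y i) (sym (ℕP.+-identityʳ i))) (C-sum≡multichoose y i 0)) (C-sum-vanish y i) ⟩
  1ℚ + 0ℚ
    ≡⟨ ℚP.+-identityʳ 1ℚ ⟩
  1ℚ ∎
C-sum≡multichoose y (suc i) (suc d) = begin
  C-sum y (suc i) (suc (i ℕ.+ suc d))
    ≡⟨ C-sum-pascal y i (i ℕ.+ suc d) ⟩
  C-sum y i (i ℕ.+ suc d) + C-sum y (suc i) (i ℕ.+ suc d)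
    ≡⟨ cong₂ _+_ (C-sum≡multichoose y i (suc d)) (cong (C-sum y (suc i)) (ℕP.+-suc i d)) ⟩
  multichoose w (suc d) + C-sum y (suc i) (suc i ℕ.+ d)
    ≡⟨ cong (multichoose w (suc d) +_) (C-sum≡multichoose y (suc i) d) ⟩
  multichoose w (suc d) + multichoose (y + ⟦ 2+i ⟧) d
    ≡⟨ cong (λ t → multichoose w (suc d) + multichoose t d) w+1 ⟩
  multichoose w (suc d) + multichoose (w + 1ℚ) d
    ≡⟨ ℚP.+-comm (multichoose w (suc d)) _ ⟩
  multichoose (w + 1ℚ) d + multichoose w (suc d)
    ≡⟨ multichoose-pascal w d ⟨
  multichoose (w + 1ℚ) (suc d)
    ≡⟨ cong (λ t → multichoose t (suc d)) w+1 ⟨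
  multichoose (y + ⟦ 2+i ⟧) (suc d) ∎
  where
  2+i = suc (suc i)
  w = y + ⟦ suc i ⟧
  w+1 : y + ⟦ 2+i ⟧ ≡ w + 1ℚ
  w+1 = begin
    y + ⟦ 2+i ⟧          ≡⟨ cong (y +_) (trans (⟦⟧-suc (suc i)) (ℚP.+-comm 1ℚ ⟦ suc i ⟧)) ⟩
    y + (⟦ suc i ⟧ + 1ℚ) ≡⟨ ℚP.+-assoc y ⟦ suc i ⟧ 1ℚ ⟨
    w + 1ℚ               ∎

⟦suc⟧-1 : ∀ s → ⟦ suc s ⟧ - 1ℚ ≡ ⟦ s ⟧
⟦suc⟧-1 s = trans (cong (_- 1ℚ) (⟦⟧-suc s)) (cancel ⟦ s ⟧)
  where
  cancel : ∀ x → (1ℚ + x) - 1ℚ ≡ x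
  cancel = solve-∀ ℚ-ring

fallingℚ-vanish : ∀ s t → s < t → fallingℚ ⟦ s ⟧ t ≡ 0ℚ
fallingℚ-vanish zero    (suc t) _         = ℚP.*-zeroˡ (fallingℚ (0ℚ - 1ℚ) t)
fallingℚ-vanish (suc s) (suc t) (s≤s s<t) = begin
  ⟦ suc s ⟧ * fallingℚ (⟦ suc s ⟧ - 1ℚ) t ≡⟨ cong (λ y → ⟦ suc s ⟧ * fallingℚ y t) (⟦suc⟧-1 s) ⟩
  ⟦ suc s ⟧ * fallingℚ ⟦ s ⟧ t            ≡⟨ cong (⟦ suc s ⟧ *_) (fallingℚ-vanish s t s<t) ⟩
  ⟦ suc s ⟧ * 0ℚ                          ≡⟨ ℚP.*-zeroʳ ⟦ suc s ⟧ ⟩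
  0ℚ                                      ∎

fallingℚ-diag : ∀ t → fallingℚ ⟦ t ⟧ t ≡ ⟦ t ℕ.! ⟧
fallingℚ-diag zero    = refl
fallingℚ-diag (suc t) = begin
  ⟦ suc t ⟧ * fallingℚ (⟦ suc t ⟧ - 1ℚ) t ≡⟨ cong (λ y → ⟦ suc t ⟧ * fallingℚ y t) (⟦suc⟧-1 t) ⟩
  ⟦ suc t ⟧ * fallingℚ ⟦ t ⟧ t            ≡⟨ cong (⟦ suc t ⟧ *_) (fallingℚ-diag t) ⟩
  ⟦ suc t ⟧ * ⟦ t ℕ.! ⟧                   ≡⟨ ⟦⟧-homo-* (suc t) (t ℕ.!) ⟨
  ⟦ suc t ℕ.! ⟧                           ∎

binomℚ-diag : ∀ t → binomℚ ⟦ t ⟧ t ≡ 1ℚ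
binomℚ-diag t = trans (cong (_* recip (t ℕ.!)) (fallingℚ-diag t)) (⟦⟧*recip (t ℕ.!) {{ℕP._!≢0 t}})

binomℚ-vanish : ∀ s t → s < t → binomℚ ⟦ s ⟧ t ≡ 0ℚ
binomℚ-vanish s t s<t = trans (cong (_* recip (t ℕ.!)) (fallingℚ-vanish s t s<t)) (ℚP.*-zeroˡ (recip (t ℕ.!)))

binomℚ-basis-unique : ∀ n (a b : ℕ → ℚ) →
  (∀ s → ∑[ t < n ] (a t * binomℚ ⟦ s ⟧ t) ≡ ∑[ t < n ] (b t * binomℚ ⟦ s ⟧ t)) →
  ∀ t → t < n → a t ≡ b t
binomℚ-basis-unique n a b a≡b = <-rec (λ t → t < n → a t ≡ b t) step
  where
  evaluate : ∀ (f : ℕ → ℚ) t → t < n →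
    ∑[ t′ < n ] (f t′ * binomℚ ⟦ t ⟧ t′) ≡ ∑[ t′ < t ] (f t′ * binomℚ ⟦ t ⟧ t′) + f t
  evaluate f t t<n = begin
    ∑[ t′ < n ] (f t′ * binomℚ ⟦ t ⟧ t′)
      ≡⟨ ∑-truncate _ t<n beyond ⟩
    ∑[ t′ < t ] (f t′ * binomℚ ⟦ t ⟧ t′) + f t * binomℚ ⟦ t ⟧ t
      ≡⟨ cong (λ x → ∑[ t′ < t ] (f t′ * binomℚ ⟦ t ⟧ t′) + f t * x) (binomℚ-diag t) ⟩
    ∑[ t′ < t ] (f t′ * binomℚ ⟦ t ⟧ t′) + f t * 1ℚ
      ≡⟨ cong (∑[ t′ < t ] (f t′ * binomℚ ⟦ t ⟧ t′) +_) (ℚP.*-identityʳ (f t)) ⟩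
    ∑[ t′ < t ] (f t′ * binomℚ ⟦ t ⟧ t′) + f t ∎
    where
    beyond : ∀ t′ → suc t ≤ t′ → f t′ * binomℚ ⟦ t ⟧ t′ ≡ 0ℚ
    beyond t′ t<t′ = trans (cong (f t′ *_) (binomℚ-vanish t t′ t<t′)) (ℚP.*-zeroʳ (f t′))
  step : ∀ t → (∀ {t′} → t′ < t → t′ < n → a t′ ≡ b t′) → t < n → a t ≡ b t
  step t IH t<n = +-cancelˡ (∑[ t′ < t ] (a t′ * binomℚ ⟦ t ⟧ t′)) (a t) (b t) (begin
    ∑[ t′ < t ] (a t′ * binomℚ ⟦ t ⟧ t′) + a t
      ≡⟨ evaluate a t t<n ⟨
    ∑[ t′ < n ] (a t′ * binomℚ ⟦ t ⟧ t′)
      ≡⟨ a≡b t ⟩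
    ∑[ t′ < n ] (b t′ * binomℚ ⟦ t ⟧ t′)
      ≡⟨ evaluate b t t<n ⟩
    ∑[ t′ < t ] (b t′ * binomℚ ⟦ t ⟧ t′) + b t
      ≡⟨ cong (_+ b t) (∑-cong t (λ t′ t′<t → cong (_* binomℚ ⟦ t ⟧ t′) (IH t′<t (ℕP.<-trans t′<t t<n)))) ⟨
    ∑[ t′ < t ] (a t′ * binomℚ ⟦ t ⟧ t′) + b t ∎)

binomℚ-shifted-basis-unique : ∀ n (a b : ℕ → ℚ) →
  (∀ X → ∑[ i < n ] (a i * binomℚ ((X + ⟦ n ⟧) - 1ℚ) (n ∸ suc i)) ≡
         ∑[ i < n ] (b i * binomℚ ((X + ⟦ n ⟧) - 1ℚ) (n ∸ suc i))) →
  ∀ i → i < n → a i ≡ b i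
binomℚ-shifted-basis-unique (suc n) a b a≡b i (s≤s i≤n) = begin
  a i
    ≡⟨ cong a (reflect i≤n) ⟨
  a (n ∸ (n ∸ i))
    ≡⟨ binomℚ-basis-unique (suc n) (a ∘ (n ∸_)) (b ∘ (n ∸_)) at-naturals (n ∸ i) (s≤s (ℕP.m∸n≤m n i)) ⟩
  b (n ∸ (n ∸ i))
    ≡⟨ cong b (reflect i≤n) ⟩
  b i ∎
  where
  reflect : ∀ {t} → t ≤ n → n ∸ (n ∸ t) ≡ t
  reflect = ℕP.m∸[m∸n]≡n
  at-naturals : ∀ s →
    ∑[ t < suc n ] (a (n ∸ t) * binomℚ ⟦ s ⟧ t) ≡ ∑[ t < suc n ] (b (n ∸ t) * binomℚ ⟦ s ⟧ t)
  at-naturals s = trans (as-polynomial a) (trans (a≡b X) (sym (as-polynomial b)))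
    where
    X = (⟦ s ⟧ + 1ℚ) - ⟦ suc n ⟧
    X+n-1 : (X + ⟦ suc n ⟧) - 1ℚ ≡ ⟦ s ⟧
    X+n-1 = cancel ⟦ s ⟧ ⟦ suc n ⟧
      where
      cancel : ∀ s n → (((s + 1ℚ) - n) + n) - 1ℚ ≡ s
      cancel = solve-∀ ℚ-ring
    as-polynomial : ∀ f →
      ∑[ t < suc n ] (f (n ∸ t) * binomℚ ⟦ s ⟧ t) ≡ ∑[ i < suc n ] (f i * binomℚ ((X + ⟦ suc n ⟧) - 1ℚ) (n ∸ i))
    as-polynomial f = begin
      ∑[ t < suc n ] (f (n ∸ t) * binomℚ ⟦ s ⟧ t)
        ≡⟨ ∑-reverse (suc n) _ ⟩
      ∑[ i < suc n ] (f (n ∸ (n ∸ i)) * binomℚ ⟦ s ⟧ (n ∸ i))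
        ≡⟨ ∑-cong (suc n) (λ i i≤n → cong (λ t → f t * binomℚ ⟦ s ⟧ (n ∸ i)) (reflect (ℕP.≤-pred i≤n))) ⟩
      ∑[ i < suc n ] (f i * binomℚ ⟦ s ⟧ (n ∸ i))
        ≡⟨ ∑-cong (suc n) (λ i _ → cong (λ y → f i * binomℚ y (n ∸ i)) (sym X+n-1)) ⟩
      ∑[ i < suc n ] (f i * binomℚ ((X + ⟦ suc n ⟧) - 1ℚ) (n ∸ i)) ∎

-- Power series

_∸ᵥ_ : ∀ {m} → Vec ℕ m → Vec ℕ m → Vec ℕ m
_∸ᵥ_ = V.zipWith _∸_

Σ-box-∷ : ∀ {m} (f : Vec ℕ (suc m) → ℚ) a as →
  Σℚ (map f (box (a ∷ as))) ≡ ∑[ b < suc a ] Σℚ (map (λ bs → f (b ∷ bs)) (box as))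
Σ-box-∷ f a as = begin
  Σℚ (map f (L.concatMap (λ b → map (b ∷_) (box as)) (L.upTo (suc a))))
    ≡⟨ Σℚ-concatMap f (λ b → map (b ∷_) (box as)) (L.upTo (suc a)) ⟩
  Σℚ (map (λ b → Σℚ (map f (map (b ∷_) (box as)))) (L.upTo (suc a)))
    ≡⟨ Σℚ-upTo _ (suc a) ⟩
  ∑[ b < suc a ] Σℚ (map f (map (b ∷_) (box as)))
    ≡⟨ ∑-cong (suc a) (λ b _ → cong Σℚ (LP.map-∘ (box as))) ⟨
  ∑[ b < suc a ] Σℚ (map (λ bs → f (b ∷ bs)) (box as)) ∎

⊛-∷ : ∀ {m} (f g : Series (suc m)) a as →
  (f ⊛ g) (a ∷ as) ≡ ∑[ b < suc a ] Σℚ (map (λ bs → f (b ∷ bs) * g ((a ∸ b) ∷ (as ∸ᵥ bs))) (box as))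
⊛-∷ f g a as = Σ-box-∷ (λ b → f b * g ((a ∷ as) ∸ᵥ b)) a as

oneS-⊛ : ∀ {m} (f : Series m) a → (oneS ⊛ f) a ≡ f a
oneS-⊛ f []       = trans (ℚP.+-identityʳ _) (ℚP.*-identityˡ (f []))
oneS-⊛ f (a ∷ as) = begin
  (oneS ⊛ f) (a ∷ as)
    ≡⟨ ⊛-∷ oneS f a as ⟩
  ∑[ b < suc a ] row b
    ≡⟨ ∑-head a row ⟩
  row 0 + ∑[ b < a ] row (suc b)
    ≡⟨ cong₂ _+_ (oneS-⊛ (f ∘ (a ∷_)) as) (∑-zero a (λ b _ → Σℚ-zero (box as) (vanish b))) ⟩
  f (a ∷ as) + 0ℚ
    ≡⟨ ℚP.+-identityʳ _ ⟩
  f (a ∷ as) ∎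
  where
  row : ℕ → ℚ
  row b = Σℚ (map (λ bs → oneS (b ∷ bs) * f ((a ∸ b) ∷ (as ∸ᵥ bs))) (box as))
  vanish : ∀ b bs → oneS (suc b ∷ bs) * f ((a ∸ suc b) ∷ (as ∸ᵥ bs)) ≡ 0ℚ
  vanish b bs = ℚP.*-zeroˡ (f ((a ∸ suc b) ∷ (as ∸ᵥ bs)))

geomProd : ∀ {m} → List (Fin m) → Series m
geomProd is = L.foldr _⊛_ oneS (map geom is)

lookup≤sum : ∀ {m} (bs : Vec ℕ m) i → V.lookup bs i ≤ V.sum bs
lookup≤sum (b ∷ bs) F.zero    = ℕP.m≤m+n b (V.sum bs)
lookup≤sum (b ∷ bs) (F.suc i) = ℕP.≤-trans (lookup≤sum bs i) (ℕP.m≤n+m (V.sum bs) b)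

geom-zero : ∀ {m} b (bs : Vec ℕ m) → geom F.zero (b ∷ bs) ≡ oneS bs
geom-zero b bs = cong (λ t → if t then 1ℚ else 0ℚ) (+≡ᵇ b (V.sum bs))
  where
  +≡ᵇ : ∀ b s → (b ℕ.+ s ℕ.≡ᵇ b) ≡ (s ℕ.≡ᵇ 0)
  +≡ᵇ zero    s = refl
  +≡ᵇ (suc b) s = +≡ᵇ b s

geom-suc-vanish : ∀ {m} (i : Fin m) b bs → geom (F.suc i) (suc b ∷ bs) ≡ 0ℚ
geom-suc-vanish i b bs with suc b ℕ.+ V.sum bs ℕ.≡ᵇ V.lookup bs i in eq
... | false = refl
... | true  = contradiction (ℕP.≡ᵇ⇒≡ _ _ (subst T (sym eq) _)) (ℕP.>⇒≢ lookup<sum)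
  where
  lookup<sum : V.lookup bs i < suc b ℕ.+ V.sum bs
  lookup<sum = s≤s (ℕP.≤-trans (lookup≤sum bs i) (ℕP.m≤n+m (V.sum bs) b))

geom-suc-⊛ : ∀ {m} (i : Fin m) (g : Series (suc m)) a as →
  (geom (F.suc i) ⊛ g) (a ∷ as) ≡ (geom i ⊛ (g ∘ (a ∷_))) as
geom-suc-⊛ i g a as = begin
  (geom (F.suc i) ⊛ g) (a ∷ as)  ≡⟨ ⊛-∷ (geom (F.suc i)) g a as ⟩
  ∑[ b < suc a ] row b           ≡⟨ ∑-head a row ⟩
  row 0 + ∑[ b < a ] row (suc b) ≡⟨ cong (row 0 +_) (∑-zero a (λ b _ → Σℚ-zero (box as) (vanish b))) ⟩
  row 0 + 0ℚ                     ≡⟨ ℚP.+-identityʳ _ ⟩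
  (geom i ⊛ (g ∘ (a ∷_))) as     ∎
  where
  row : ℕ → ℚ
  row b = Σℚ (map (λ bs → geom (F.suc i) (b ∷ bs) * g ((a ∸ b) ∷ (as ∸ᵥ bs))) (box as))
  vanish : ∀ b bs → geom (F.suc i) (suc b ∷ bs) * g ((a ∸ suc b) ∷ (as ∸ᵥ bs)) ≡ 0ℚ
  vanish b bs = begin
    geom (F.suc i) (suc b ∷ bs) * g′ ≡⟨ cong (_* g′) (geom-suc-vanish i b bs) ⟩
    0ℚ * g′                          ≡⟨ ℚP.*-zeroˡ g′ ⟩
    0ℚ                               ∎
    where g′ = g ((a ∸ suc b) ∷ (as ∸ᵥ bs))

geomProd-suc-zero : ∀ {m} (is : List (Fin m)) as → geomProd (map F.suc is) (0 ∷ as) ≡ geomProd is as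
geomProd-suc-zero []       as = refl
geomProd-suc-zero (i ∷ is) as = trans (geom-suc-⊛ i (geomProd (map F.suc is)) 0 as)
  (Σℚ-cong (box as) (λ bs → cong (geom i bs *_) (geomProd-suc-zero is (as ∸ᵥ bs))))

geomProd-suc-suc : ∀ {m} (is : List (Fin m)) a as → geomProd (map F.suc is) (suc a ∷ as) ≡ 0ℚ
geomProd-suc-suc []       a as = refl
geomProd-suc-suc (i ∷ is) a as = trans (geom-suc-⊛ i (geomProd (map F.suc is)) (suc a) as) (Σℚ-zero (box as) vanish)
  where
  vanish : ∀ bs → geom i bs * geomProd (map F.suc is) (suc a ∷ (as ∸ᵥ bs)) ≡ 0ℚ
  vanish bs = trans (cong (geom i bs *_) (geomProd-suc-suc is a (as ∸ᵥ bs))) (ℚP.*-zeroʳ (geom i bs))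

invProd-coeff : ∀ m a → invProd m a ≡ 1ℚ
invProd-coeff zero    []       = refl
invProd-coeff (suc m) (a ∷ as) = begin
  invProd (suc m) (a ∷ as)
    ≡⟨ cong (λ is → (geom F.zero ⊛ geomProd is) (a ∷ as)) (LP.map-tabulate (λ i → i) F.suc) ⟨
  (geom F.zero ⊛ P) (a ∷ as)
    ≡⟨ ⊛-∷ (geom F.zero) P a as ⟩
  ∑[ b < suc a ] Σℚ (map (λ bs → geom F.zero (b ∷ bs) * P ((a ∸ b) ∷ (as ∸ᵥ bs))) (box as))
    ≡⟨ ∑-cong (suc a) (λ b _ → Σℚ-cong (box as) (first-geom b)) ⟩
  ∑[ b < suc a ] (oneS ⊛ (P ∘ ((a ∸ b) ∷_))) as
    ≡⟨ ∑-cong (suc a) (λ b _ → oneS-⊛ (P ∘ ((a ∸ b) ∷_)) as) ⟩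
  ∑[ b < suc a ] P ((a ∸ b) ∷ as)
    ≡⟨ only-last a ⟩
  1ℚ ∎
  where
  P = geomProd (map F.suc (L.allFin m))
  first-geom : ∀ b bs → geom F.zero (b ∷ bs) * P ((a ∸ b) ∷ (as ∸ᵥ bs)) ≡ oneS bs * P ((a ∸ b) ∷ (as ∸ᵥ bs))
  first-geom b bs = cong (_* P ((a ∸ b) ∷ (as ∸ᵥ bs))) (geom-zero b bs)
  only-last : ∀ a → ∑[ b < suc a ] P ((a ∸ b) ∷ as) ≡ 1ℚ
  only-last zero    = trans (ℚP.+-identityˡ _) (trans (geomProd-suc-zero (L.allFin m) as) (invProd-coeff m as))
  only-last (suc a) = begin
    ∑[ b < suc (suc a) ] P ((suc a ∸ b) ∷ as)
      ≡⟨ ∑-head (suc a) _ ⟩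
    P (suc a ∷ as) + ∑[ b < suc a ] P ((a ∸ b) ∷ as)
      ≡⟨ cong₂ _+_ (geomProd-suc-suc (L.allFin m) a as) (only-last a) ⟩
    0ℚ + 1ℚ
      ≡⟨ ℚP.+-identityˡ 1ℚ ⟩
    1ℚ ∎

risingWeight : ℕ → ∀ {m} → Vec ℕ m → ℚ
risingWeight j a = Πℚ (V.toList (V.map (λ c → ⟦ rising j c ⟧ * recip (c ℕ.!)) a))

risingWeight-zero : ∀ {m} (a : Vec ℕ m) → risingWeight 0 a ≡ oneS a
risingWeight-zero []           = refl
risingWeight-zero (zero  ∷ as) = trans (ℚP.*-identityˡ (risingWeight 0 as)) (risingWeight-zero as)
risingWeight-zero (suc c ∷ as) = begin
  0ℚ * recip (suc c ℕ.!) * risingWeight 0 as ≡⟨ cong (_* risingWeight 0 as) (ℚP.*-zeroˡ (recip (suc c ℕ.!))) ⟩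
  0ℚ * risingWeight 0 as                     ≡⟨ ℚP.*-zeroˡ (risingWeight 0 as) ⟩
  0ℚ                                         ∎

∑-rising : ∀ j a →
  ∑[ b < suc a ] (⟦ rising j (a ∸ b) ⟧ * recip ((a ∸ b) ℕ.!)) ≡ ⟦ rising (suc j) a ⟧ * recip (a ℕ.!)
∑-rising j a = begin
  ∑[ b < suc a ] (⟦ rising j (a ∸ b) ⟧ * recip ((a ∸ b) ℕ.!))
    ≡⟨ ∑-cong (suc a) (λ b _ → rising≡multichoose j (a ∸ b)) ⟩
  ∑[ b < suc a ] multichoose ⟦ j ⟧ (a ∸ b)
    ≡⟨ ∑-multichoose ⟦ j ⟧ a ⟩
  multichoose (⟦ j ⟧ + 1ℚ) a
    ≡⟨ cong (λ y → multichoose y a) (trans (ℚP.+-comm ⟦ j ⟧ 1ℚ) (sym (⟦⟧-suc j))) ⟩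
  multichoose ⟦ suc j ⟧ a
    ≡⟨ rising≡multichoose (suc j) a ⟨
  ⟦ rising (suc j) a ⟧ * recip (a ℕ.!) ∎

Σ-box-risingWeight : ∀ j {m} (a : Vec ℕ m) →
  Σℚ (map (λ b → risingWeight j (a ∸ᵥ b)) (box a)) ≡ risingWeight (suc j) a
Σ-box-risingWeight j []       = ℚP.+-identityʳ 1ℚ
Σ-box-risingWeight j (a ∷ as) = begin
  Σℚ (map (λ b → risingWeight j ((a ∷ as) ∸ᵥ b)) (box (a ∷ as)))
    ≡⟨ Σ-box-∷ _ a as ⟩
  ∑[ b < suc a ] Σℚ (map (λ bs → w (a ∸ b) * risingWeight j (as ∸ᵥ bs)) (box as))
    ≡⟨ ∑-cong (suc a) (λ b _ → Σℚ-distribˡ (w (a ∸ b)) _ (box as)) ⟨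
  ∑[ b < suc a ] (w (a ∸ b) * Σℚ (map (λ bs → risingWeight j (as ∸ᵥ bs)) (box as)))
    ≡⟨ ∑-cong (suc a) (λ b _ → cong (w (a ∸ b) *_) (Σ-box-risingWeight j as)) ⟩
  ∑[ b < suc a ] (w (a ∸ b) * risingWeight (suc j) as)
    ≡⟨ ∑-distribʳ (suc a) _ (λ b → w (a ∸ b)) ⟨
  ∑[ b < suc a ] w (a ∸ b) * risingWeight (suc j) as
    ≡⟨ cong (_* risingWeight (suc j) as) (∑-rising j a) ⟩
  risingWeight (suc j) (a ∷ as) ∎
  where
  w : ℕ → ℚ
  w c = ⟦ rising j c ⟧ * recip (c ℕ.!)

invProd-⊛-risingWeight : ∀ m j a → (invProd m ⊛ risingWeight j) a ≡ risingWeight (suc j) a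
invProd-⊛-risingWeight m j a = begin
  (invProd m ⊛ risingWeight j) a
    ≡⟨ Σℚ-cong (box a) (λ b → cong (_* risingWeight j (a ∸ᵥ b)) (invProd-coeff m b)) ⟩
  Σℚ (map (λ b → 1ℚ * risingWeight j (a ∸ᵥ b)) (box a))
    ≡⟨ Σℚ-cong (box a) (λ b → ℚP.*-identityˡ _) ⟩
  Σℚ (map (λ b → risingWeight j (a ∸ᵥ b)) (box a))
    ≡⟨ Σ-box-risingWeight j a ⟩
  risingWeight (suc j) a ∎

invProd⊖1 : (m : ℕ) → Series m
invProd⊖1 m = invProd m ⊖ oneS

invProd-split : ∀ m b → invProd m b ≡ oneS b + invProd⊖1 m b
invProd-split m b = begin
  invProd m b            ≡⟨ invProd-coeff m b ⟩
  1ℚ                     ≡⟨ x+[1-x] (oneS b) ⟨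
  oneS b + (1ℚ - oneS b) ≡⟨ cong (λ t → oneS b + (t - oneS b)) (invProd-coeff m b) ⟨
  oneS b + invProd⊖1 m b ∎
  where
  x+[1-x] : ∀ x → x + (1ℚ - x) ≡ 1ℚ
  x+[1-x] = solve-∀ ℚ-ring

⊛-distribʳ-⊕ : ∀ {m} (f g h : Series m) a → ((f ⊕ g) ⊛ h) a ≡ (f ⊛ h) a + (g ⊛ h) a
⊛-distribʳ-⊕ f g h a = trans
  (Σℚ-cong (box a) (λ b → ℚP.*-distribʳ-+ (h (a ∸ᵥ b)) (f b) (g b)))
  (Σℚ-distrib-+ (λ b → f b * h (a ∸ᵥ b)) (λ b → g b * h (a ∸ᵥ b)) (box a))

⊛-∑ : ∀ {m} n (c : ℕ → ℚ) (f : Series m) (g : ℕ → Series m) a →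
  (f ⊛ (λ b → ∑[ i < n ] (c i * g i b))) a ≡ ∑[ i < n ] (c i * (f ⊛ g i) a)
⊛-∑ n c f g a = begin
  Σℚ (map (λ b → f b * ∑[ i < n ] (c i * g i (a ∸ᵥ b))) (box a))
    ≡⟨ Σℚ-cong (box a) (λ b → ∑-distribˡ n (f b) _) ⟩
  Σℚ (map (λ b → ∑[ i < n ] (f b * (c i * g i (a ∸ᵥ b)))) (box a))
    ≡⟨ Σℚ-∑ n _ (box a) ⟩
  ∑[ i < n ] Σℚ (map (λ b → f b * (c i * g i (a ∸ᵥ b))) (box a))
    ≡⟨ ∑-cong n (λ i _ → Σℚ-cong (box a) (λ b → ℚ*.x∙yz≈y∙xz (f b) (c i) _)) ⟩
  ∑[ i < n ] Σℚ (map (λ b → c i * (f b * g i (a ∸ᵥ b))) (box a))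
    ≡⟨ ∑-cong n (λ i _ → Σℚ-distribˡ (c i) _ (box a)) ⟨
  ∑[ i < n ] (c i * (f ⊛ g i) a) ∎

∑-C-pascal : ∀ j (s : ℕ → ℚ) →
  ∑[ i < suc j ] (⟦ j C i ⟧ * s i) + ∑[ i < suc j ] (⟦ j C i ⟧ * s (suc i)) ≡
  ∑[ i < suc (suc j) ] (⟦ suc j C i ⟧ * s i)
∑-C-pascal j s = begin
  ∑[ i < suc j ] (⟦ j C i ⟧ * s i) + B
    ≡⟨ cong (_+ B) (∑-head j f) ⟩
  (1ℚ * s 0 + ∑< j (f ∘ suc)) + B
    ≡⟨ cong (λ t → (1ℚ * s 0 + t) + B) (∑-truncate (f ∘ suc) (ℕP.n≤1+n j) vanish) ⟨
  (1ℚ * s 0 + A) + B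
    ≡⟨ ℚP.+-assoc (1ℚ * s 0) A B ⟩
  1ℚ * s 0 + (A + B)
    ≡⟨ cong (1ℚ * s 0 +_) (∑-distrib-+ (suc j) _ _) ⟨
  1ℚ * s 0 + ∑[ i < suc j ] (⟦ j C suc i ⟧ * s (suc i) + ⟦ j C i ⟧ * s (suc i))
    ≡⟨ cong (1ℚ * s 0 +_) (∑-cong (suc j) (λ i _ → pascal i)) ⟩
  1ℚ * s 0 + ∑[ i < suc j ] (⟦ suc j C suc i ⟧ * s (suc i))
    ≡⟨ ∑-head (suc j) _ ⟨
  ∑[ i < suc (suc j) ] (⟦ suc j C i ⟧ * s i) ∎
  where
  f : ℕ → ℚ
  f i = ⟦ j C i ⟧ * s i
  vanish : ∀ i → j ≤ i → f (suc i) ≡ 0ℚ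
  vanish i j≤i = begin
    ⟦ j C suc i ⟧ * s (suc i) ≡⟨ cong (λ t → ⟦ t ⟧ * s (suc i)) (k>n⇒nCk≡0 (s≤s j≤i)) ⟩
    0ℚ * s (suc i)            ≡⟨ ℚP.*-zeroˡ (s (suc i)) ⟩
    0ℚ                        ∎
  A = ∑[ i < suc j ] (⟦ j C suc i ⟧ * s (suc i))
  B = ∑[ i < suc j ] (⟦ j C i ⟧ * s (suc i))
  pascal : ∀ i → ⟦ j C suc i ⟧ * s (suc i) + ⟦ j C i ⟧ * s (suc i) ≡ ⟦ suc j C suc i ⟧ * s (suc i)
  pascal i = begin
    ⟦ j C suc i ⟧ * s (suc i) + ⟦ j C i ⟧ * s (suc i)
      ≡⟨ ℚP.*-distribʳ-+ (s (suc i)) ⟦ j C suc i ⟧ ⟦ j C i ⟧ ⟨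
    (⟦ j C suc i ⟧ + ⟦ j C i ⟧) * s (suc i)
      ≡⟨ cong (_* s (suc i)) (ℚP.+-comm ⟦ j C suc i ⟧ ⟦ j C i ⟧) ⟩
    (⟦ j C i ⟧ + ⟦ j C suc i ⟧) * s (suc i)
      ≡⟨ cong (_* s (suc i)) (⟦⟧-homo-+ (j C i) (j C suc i)) ⟨
    ⟦ j C i ℕ.+ j C suc i ⟧ * s (suc i)
      ≡⟨ cong (λ t → ⟦ t ⟧ * s (suc i)) (nCk+nC[k+1]≡[n+1]C[k+1] j i) ⟩
    ⟦ suc j C suc i ⟧ * s (suc i) ∎

risingWeight-binomial : ∀ m j (a : Vec ℕ m) → risingWeight j a ≡ ∑[ i < suc j ] (⟦ j C i ⟧ * (invProd⊖1 m ^S i) a)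
risingWeight-binomial m zero    a = begin
  risingWeight 0 a ≡⟨ risingWeight-zero a ⟩
  oneS a           ≡⟨ ℚP.*-identityˡ (oneS a) ⟨
  1ℚ * oneS a      ≡⟨ ℚP.+-identityˡ _ ⟨
  0ℚ + 1ℚ * oneS a ∎
risingWeight-binomial m (suc j) a = begin
  risingWeight (suc j) a
    ≡⟨ invProd-⊛-risingWeight m j a ⟨
  (invProd m ⊛ risingWeight j) a
    ≡⟨ Σℚ-cong (box a) (λ b → cong (_* risingWeight j (a ∸ᵥ b)) (invProd-split m b)) ⟩
  ((oneS ⊕ Q) ⊛ risingWeight j) a
    ≡⟨ ⊛-distribʳ-⊕ oneS Q (risingWeight j) a ⟩
  (oneS ⊛ risingWeight j) a + (Q ⊛ risingWeight j) a
    ≡⟨ cong₂ _+_ (oneS-⊛ (risingWeight j) a) (Σℚ-cong (box a) (λ b → cong (Q b *_) (expand (a ∸ᵥ b)))) ⟩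
  risingWeight j a + (Q ⊛ (λ b → ∑[ i < suc j ] (⟦ j C i ⟧ * (Q ^S i) b))) a
    ≡⟨ cong₂ _+_ (expand a) (⊛-∑ (suc j) (λ i → ⟦ j C i ⟧) Q (Q ^S_) a) ⟩
  ∑[ i < suc j ] (⟦ j C i ⟧ * (Q ^S i) a) + ∑[ i < suc j ] (⟦ j C i ⟧ * (Q ^S suc i) a)
    ≡⟨ ∑-C-pascal j (λ i → (Q ^S i) a) ⟩
  ∑[ i < suc (suc j) ] (⟦ suc j C i ⟧ * (Q ^S i) a) ∎
  where
  Q = invProd⊖1 m
  expand = risingWeight-binomial m j

ℕ-valued : ℚ → Set
ℕ-valued x = ∃ λ N → x ≡ ⟦ N ⟧

ℕ-valued-+ : ∀ {x y} → ℕ-valued x → ℕ-valued y → ℕ-valued (x + y)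
ℕ-valued-+ (a , refl) (b , refl) = a ℕ.+ b , sym (⟦⟧-homo-+ a b)

ℕ-valued-* : ∀ {x y} → ℕ-valued x → ℕ-valued y → ℕ-valued (x * y)
ℕ-valued-* (a , refl) (b , refl) = a ℕ.* b , sym (⟦⟧-homo-* a b)

ℕ-valued-Σℚ : ∀ {A : Set} (f : A → ℚ) xs → (∀ x → ℕ-valued (f x)) → ℕ-valued (Σℚ (map f xs))
ℕ-valued-Σℚ f []       _ = 0 , refl
ℕ-valued-Σℚ f (x ∷ xs) h = ℕ-valued-+ (h x) (ℕ-valued-Σℚ f xs h)

ℕ-valued-oneS : ∀ {m} (b : Vec ℕ m) → ℕ-valued (oneS b)
ℕ-valued-oneS b with V.sum b ℕ.≡ᵇ 0
... | true  = 1 , refl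
... | false = 0 , refl

ℕ-valued-invProd⊖1 : ∀ m (b : Vec ℕ m) → ℕ-valued (invProd⊖1 m b)
ℕ-valued-invProd⊖1 m b rewrite invProd-coeff m b with V.sum b ℕ.≡ᵇ 0
... | true  = 0 , refl
... | false = 1 , refl

ℕ-valued-invProd⊖1^S : ∀ m i (a : Vec ℕ m) → ℕ-valued ((invProd⊖1 m ^S i) a)
ℕ-valued-invProd⊖1^S m zero    a = ℕ-valued-oneS a
ℕ-valued-invProd⊖1^S m (suc i) a = ℕ-valued-Σℚ _ (box a)
  (λ b → ℕ-valued-* (ℕ-valued-invProd⊖1 m b) (ℕ-valued-invProd⊖1^S m i (a ∸ᵥ b)))

-- Partitions

partitionsAux-fuel : ∀ f f′ N b → N ≤ f → N ≤ f′ → partitionsAux f N b ≡ partitionsAux f′ N b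
partitionsAux-fuel f       f′       zero    b _         _          = refl
partitionsAux-fuel (suc f) (suc f′) (suc n) b (s≤s n≤f) (s≤s n≤f′) = begin
  L.concatMap (parts f) (map suc (L.upTo (b ⊓ suc n)))  ≡⟨ LP.concatMap-map (parts f) suc (L.upTo (b ⊓ suc n)) ⟩
  L.concatMap (parts f ∘ suc) (L.upTo (b ⊓ suc n))      ≡⟨ LP.concatMap-cong same (L.upTo (b ⊓ suc n)) ⟩
  L.concatMap (parts f′ ∘ suc) (L.upTo (b ⊓ suc n))     ≡⟨ LP.concatMap-map (parts f′) suc (L.upTo (b ⊓ suc n)) ⟨
  L.concatMap (parts f′) (map suc (L.upTo (b ⊓ suc n))) ∎
  where
  parts : ℕ → ℕ → List (List ℕ)
  parts fuel i = map (i ∷_) (partitionsAux fuel (suc n ∸ i) i)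
  same : ∀ x → parts f (suc x) ≡ parts f′ (suc x)
  same x = cong (map (suc x ∷_)) (partitionsAux-fuel f f′ (n ∸ x) (suc x)
    (ℕP.≤-trans (ℕP.m∸n≤m n x) n≤f) (ℕP.≤-trans (ℕP.m∸n≤m n x) n≤f′))

partSum : (List ℕ → ℚ) → ℕ → ℕ → ℚ
partSum g N b = Σℚ (map g (partitionsAux N N b))

Σℚ-partitionsAux : ∀ (g : List ℕ → ℚ) f n b →
  Σℚ (map g (partitionsAux (suc f) (suc n) b)) ≡
  ∑[ x < b ⊓ suc n ] Σℚ (map (g ∘ (suc x ∷_)) (partitionsAux f (n ∸ x) (suc x)))
Σℚ-partitionsAux g f n b = begin
  Σℚ (map g (L.concatMap parts (map suc (L.upTo (b ⊓ suc n)))))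
    ≡⟨ cong (Σℚ ∘ map g) (LP.concatMap-map parts suc (L.upTo (b ⊓ suc n))) ⟩
  Σℚ (map g (L.concatMap (parts ∘ suc) (L.upTo (b ⊓ suc n))))
    ≡⟨ Σℚ-concatMap g (parts ∘ suc) (L.upTo (b ⊓ suc n)) ⟩
  Σℚ (map (λ x → Σℚ (map g (parts (suc x)))) (L.upTo (b ⊓ suc n)))
    ≡⟨ Σℚ-upTo _ (b ⊓ suc n) ⟩
  ∑[ x < b ⊓ suc n ] Σℚ (map g (parts (suc x)))
    ≡⟨ ∑-cong (b ⊓ suc n) (λ x _ → cong Σℚ (LP.map-∘ (partitionsAux f (n ∸ x) (suc x)))) ⟨
  ∑[ x < b ⊓ suc n ] Σℚ (map (g ∘ (suc x ∷_)) (partitionsAux f (n ∸ x) (suc x))) ∎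
  where
  parts : ℕ → List (List ℕ)
  parts i = map (i ∷_) (partitionsAux f (suc n ∸ i) i)

partSum-largest : ∀ g n b → partSum g (suc n) b ≡ ∑[ x < b ⊓ suc n ] partSum (g ∘ (suc x ∷_)) (n ∸ x) (suc x)
partSum-largest g n b = trans (Σℚ-partitionsAux g n n b) (∑-cong (b ⊓ suc n) (λ x _ →
  cong (Σℚ ∘ map (g ∘ (suc x ∷_)))
       (partitionsAux-fuel n (n ∸ x) (n ∸ x) (suc x) (ℕP.m∸n≤m n x) ℕP.≤-refl)))

Partition : ℕ → ℕ → List ℕ → Set
Partition N b μ = ℕL.sum μ ≡ N × All (_≤ b) μ

Σℚ-partitionsAux-cong : ∀ f N b {g g′ : List ℕ → ℚ} → (∀ μ → Partition N b μ → g μ ≡ g′ μ) →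
  Σℚ (map g (partitionsAux f N b)) ≡ Σℚ (map g′ (partitionsAux f N b))
Σℚ-partitionsAux-cong f       zero    b g≡g′ = cong (_+ 0ℚ) (g≡g′ [] (refl , []))
Σℚ-partitionsAux-cong zero    (suc n) b g≡g′ = refl
Σℚ-partitionsAux-cong (suc f) (suc n) b {g} {g′} g≡g′ = begin
  Σℚ (map g (partitionsAux (suc f) (suc n) b))
    ≡⟨ Σℚ-partitionsAux g f n b ⟩
  _
    ≡⟨ ∑-cong (b ⊓ suc n) (λ x x< → Σℚ-partitionsAux-cong f (n ∸ x) (suc x) (on-tail x x<)) ⟩
  _
    ≡⟨ Σℚ-partitionsAux g′ f n b ⟨
  Σℚ (map g′ (partitionsAux (suc f) (suc n) b)) ∎
  where
  extend : ∀ x → x < b ⊓ suc n → ∀ ν → Partition (n ∸ x) (suc x) ν → Partition (suc n) b (suc x ∷ ν)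
  extend x x< ν (sum≡ , ν≤) =
    cong suc (trans (cong (x ℕ.+_) sum≡) (ℕP.m+[n∸m]≡n (ℕP.≤-pred (ℕP.m<n⊓o⇒m<o b (suc n) x<)))) ,
    (ℕP.m<n⊓o⇒m<n b (suc n) x< ∷ All.map (λ y≤1+x → ℕP.≤-trans y≤1+x (ℕP.m<n⊓o⇒m<n b (suc n) x<)) ν≤)
  on-tail : ∀ x → x < b ⊓ suc n → ∀ ν → Partition (n ∸ x) (suc x) ν → g (suc x ∷ ν) ≡ g′ (suc x ∷ ν)
  on-tail x x< ν p = g≡g′ (suc x ∷ ν) (extend x x< ν p)

partSum-cong : ∀ N b {g g′ : List ℕ → ℚ} → (∀ μ → Partition N b μ → g μ ≡ g′ μ) →
  partSum g N b ≡ partSum g′ N b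
partSum-cong N = Σℚ-partitionsAux-cong N N

partSum-distribˡ : ∀ c (g : List ℕ → ℚ) N b → c * partSum g N b ≡ partSum (λ μ → c * g μ) N b
partSum-distribˡ c g N b = Σℚ-distribˡ c g (partitionsAux N N b)

partSum-distrib-+ : ∀ (g h : List ℕ → ℚ) N b → partSum (λ μ → g μ + h μ) N b ≡ partSum g N b + partSum h N b
partSum-distrib-+ g h N b = Σℚ-distrib-+ g h (partitionsAux N N b)

partSum-bound : ∀ g N {b b′} → N ≤ b → N ≤ b′ → partSum g N b ≡ partSum g N b′
partSum-bound g zero    _   _    = refl
partSum-bound g (suc n) {b} {b′} n<b n<b′ = begin
  partSum g (suc n) b  ≡⟨ partSum-largest g n b ⟩
  ∑< (b ⊓ suc n) _     ≡⟨ cong (λ k → ∑< k _) (trans (ℕP.m≥n⇒m⊓n≡n n<b) (sym (ℕP.m≥n⇒m⊓n≡n n<b′))) ⟩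
  ∑< (b′ ⊓ suc n) _    ≡⟨ partSum-largest g n b′ ⟨
  partSum g (suc n) b′ ∎

partSum-suc-bound : ∀ g n b → b ≤ n →
  partSum g (suc n) (suc b) ≡ partSum g (suc n) b + partSum (g ∘ (suc b ∷_)) (n ∸ b) (suc b)
partSum-suc-bound g n b b≤n = begin
  partSum g (suc n) (suc b)    ≡⟨ partSum-largest g n (suc b) ⟩
  ∑< (suc b ⊓ suc n) part      ≡⟨ cong (λ k → ∑< k part) (ℕP.m≤n⇒m⊓n≡m (s≤s b≤n)) ⟩
  ∑< b part + part b           ≡⟨ cong (λ k → ∑< k part + part b) (ℕP.m≤n⇒m⊓n≡m (ℕP.m≤n⇒m≤1+n b≤n)) ⟨
  ∑< (b ⊓ suc n) part + part b ≡⟨ cong (_+ part b) (partSum-largest g n b) ⟨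
  partSum g (suc n) b + part b ∎
  where
  part : ℕ → ℚ
  part x = partSum (g ∘ (suc x ∷_)) (n ∸ x) (suc x)

byMultiplicity : (List ℕ → ℚ) → ℕ → ℕ → ℚ
byMultiplicity g N b =
  ∑[ m < suc N ] guard (m ℕ.* suc b) N (partSum (g ∘ (replicate m (suc b) ++_)) (N ∸ m ℕ.* suc b) b)

-- Strips off all parts equal to b + 1 at once; this is how z_μ factorises.
partSum-multiplicity : ∀ b N g → partSum g N (suc b) ≡ byMultiplicity g N b
partSum-multiplicity b = <-rec (λ N → ∀ g → partSum g N (suc b) ≡ byMultiplicity g N b) step
  where
  B = suc b

  blocks : (List ℕ → ℚ) → ℕ → ℕ → ℚ
  blocks g m k = partSum (g ∘ (replicate m B ++_)) k b

  rest : (List ℕ → ℚ) → ℕ → ℕ → ℚ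
  rest g N m = guard (suc m ℕ.* B) N (blocks g (suc m) (N ∸ suc m ℕ.* B))

  split-zero : ∀ g N → byMultiplicity g N b ≡ partSum g N b + ∑< N (rest g N)
  split-zero g N = trans (∑-head N (λ m → guard (m ℕ.* B) N (blocks g m (N ∸ m ℕ.* B))))
    (cong (_+ ∑< N (rest g N)) (guard-yes {k = N} (partSum g N b) z≤n))

  small : ∀ g N → N < B → partSum g N B ≡ byMultiplicity g N b
  small g N N≤b = begin
    partSum g N B                   ≡⟨ partSum-bound g N (ℕP.m≤n⇒m≤1+n (ℕP.≤-pred N≤b)) (ℕP.≤-pred N≤b) ⟩
    partSum g N b                   ≡⟨ ℚP.+-identityʳ (partSum g N b) ⟨
    partSum g N b + 0ℚ              ≡⟨ cong (partSum g N b +_) (∑-zero N (λ m _ → guard-no _ (too-big m))) ⟨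
    partSum g N b + ∑< N (rest g N) ≡⟨ split-zero g N ⟨
    byMultiplicity g N b            ∎
    where
    too-big : ∀ m → ¬ suc m ℕ.* B ≤ N
    too-big m mB≤N = ℕP.<⇒≱ N≤b (ℕP.≤-trans (ℕP.m≤m+n B (m ℕ.* B)) mB≤N)

  large : ∀ g n → B ≤ suc n → (∀ g′ → partSum g′ (n ∸ b) B ≡ byMultiplicity g′ (n ∸ b) b) →
          partSum g (suc n) B ≡ byMultiplicity g (suc n) b
  large g n (s≤s b≤n) IH = begin
    partSum g (suc n) B
      ≡⟨ partSum-suc-bound g n b b≤n ⟩
    partSum g (suc n) b + partSum (g ∘ (B ∷_)) (n ∸ b) B
      ≡⟨ cong (partSum g (suc n) b +_) (IH (g ∘ (B ∷_))) ⟩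
    partSum g (suc n) b + ∑< (suc (n ∸ b)) shifted
      ≡⟨ cong (partSum g (suc n) b +_) (∑-truncate shifted (s≤s (ℕP.m∸n≤m n b)) beyond) ⟨
    partSum g (suc n) b + ∑< (suc n) shifted
      ≡⟨ cong (partSum g (suc n) b +_) (∑-cong (suc n) (λ m _ → unshift m)) ⟩
    partSum g (suc n) b + ∑< (suc n) (rest g (suc n))
      ≡⟨ split-zero g (suc n) ⟨
    byMultiplicity g (suc n) b ∎
    where
    shifted : ℕ → ℚ
    shifted m = guard (m ℕ.* B) (n ∸ b) (blocks g (suc m) ((n ∸ b) ∸ m ℕ.* B))
    beyond : ∀ m → suc (n ∸ b) ≤ m → shifted m ≡ 0ℚ
    beyond m n∸b<m = guard-no _ (ℕP.<⇒≱ (ℕP.<-≤-trans n∸b<m (ℕP.m≤m*n m B)))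
    unshift : ∀ m → shifted m ≡ rest g (suc n) m
    unshift m = begin
      shifted m
        ≡⟨ cong (guard (m ℕ.* B) (n ∸ b) ∘ blocks g (suc m)) (ℕP.∸-+-assoc (suc n) B (m ℕ.* B)) ⟩
      guard (m ℕ.* B) (suc n ∸ B) (blocks g (suc m) (suc n ∸ suc m ℕ.* B))
        ≡⟨ guard-shift B (m ℕ.* B) (suc n) _ (s≤s b≤n) ⟨
      rest g (suc n) m ∎

  step : ∀ N → (∀ {N′} → N′ < N → ∀ g → partSum g N′ B ≡ byMultiplicity g N′ b) →
         ∀ g → partSum g N B ≡ byMultiplicity g N b
  step N IH g with B ℕ.≤? N
  ... | no  B≰N = small g N (ℕP.≰⇒> B≰N)
  step (suc n) IH g | yes B≤N = large g n B≤N (IH (s≤s (ℕP.m∸n≤m n b)))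

partSum-replicate : ∀ (g : List ℕ → ℚ) (h : ℕ → List ℕ → ℚ) b N →
  (∀ m ν → All (_≤ b) ν → g (replicate m (suc b) ++ ν) ≡ h m ν) →
  partSum g N (suc b) ≡ ∑[ m < suc N ] guard (m ℕ.* suc b) N (partSum (h m) (N ∸ m ℕ.* suc b) b)
partSum-replicate g h b N g≡h = trans (partSum-multiplicity b N g) (∑-cong (suc N) (λ m _ →
  cong (guard (m ℕ.* suc b) N) (partSum-cong (N ∸ m ℕ.* suc b) b (λ ν (_ , ν≤b) → g≡h m ν ν≤b))))

∏< : ℕ → (ℕ → ℕ) → ℕ
∏< zero    f = 1
∏< (suc K) f = ∏< K f ℕ.* f K

product-upTo : ∀ (f : ℕ → ℕ) K → ℕL.product (map f (L.upTo K)) ≡ ∏< K f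
product-upTo f K = trans (cong ℕL.product (LP.map-upTo f K)) (go f K)
  where
  go : ∀ (f : ℕ → ℕ) K → ℕL.product (L.applyUpTo f K) ≡ ∏< K f
  go f zero    = refl
  go f (suc K) = begin
    f 0 ℕ.* ℕL.product (L.applyUpTo (f ∘ suc) K) ≡⟨ cong (f 0 ℕ.*_) (go (f ∘ suc) K) ⟩
    f 0 ℕ.* ∏< K (f ∘ suc)                       ≡⟨ head K f ⟨
    ∏< (suc K) f                                 ∎
    where
    head : ∀ K (f : ℕ → ℕ) → ∏< (suc K) f ≡ f 0 ℕ.* ∏< K (f ∘ suc)
    head zero    f = trans (ℕP.*-identityˡ (f 0)) (sym (ℕP.*-identityʳ (f 0)))
    head (suc K) f = trans (cong (ℕ._* f (suc K)) (head K f)) (ℕP.*-assoc (f 0) _ _)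

∏-cong : ∀ K {f g : ℕ → ℕ} → (∀ i → i < K → f i ≡ g i) → ∏< K f ≡ ∏< K g
∏-cong zero    f≡g = refl
∏-cong (suc K) f≡g = cong₂ ℕ._*_ (∏-cong K (λ i i<K → f≡g i (ℕP.m<n⇒m<1+n i<K))) (f≡g K ℕP.≤-refl)

∏-truncate : ∀ {k n} (f : ℕ → ℕ) → k ≤ n → (∀ i → k ≤ i → f i ≡ 1) → ∏< n f ≡ ∏< k f
∏-truncate {k} f k≤n f≡1 = trans (cong (λ t → ∏< t f) (sym (ℕP.m+[n∸m]≡n k≤n))) (extra _)
  where
  extra : ∀ d → ∏< (k ℕ.+ d) f ≡ ∏< k f
  extra zero    = cong (λ t → ∏< t f) (ℕP.+-identityʳ k)
  extra (suc d) = begin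
    ∏< (k ℕ.+ suc d) f             ≡⟨ cong (λ t → ∏< t f) (ℕP.+-suc k d) ⟩
    ∏< (k ℕ.+ d) f ℕ.* f (k ℕ.+ d) ≡⟨ cong₂ ℕ._*_ (extra d) (f≡1 (k ℕ.+ d) (ℕP.m≤m+n k d)) ⟩
    ∏< k f ℕ.* 1                   ≡⟨ ℕP.*-identityʳ (∏< k f) ⟩
    ∏< k f                         ∎

∏-update : ∀ K t {f g : ℕ → ℕ} → t < K → g t ≡ 1 → (∀ i → i < K → i ≢ t → f i ≡ g i) →
  ∏< K f ≡ f t ℕ.* ∏< K g
∏-update (suc K) t {f} {g} t<1+K gt≡1 f≡g with t ℕ.≟ K
... | yes refl = begin
  ∏< K f ℕ.* f K         ≡⟨ cong (ℕ._* f K) (∏-cong K (λ i i<K → f≡g i (ℕP.m<n⇒m<1+n i<K) (ℕP.<⇒≢ i<K))) ⟩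
  ∏< K g ℕ.* f K         ≡⟨ ℕP.*-comm (∏< K g) (f K) ⟩
  f K ℕ.* ∏< K g         ≡⟨ cong (f K ℕ.*_) (ℕP.*-identityʳ (∏< K g)) ⟨
  f K ℕ.* (∏< K g ℕ.* 1) ≡⟨ cong (λ x → f K ℕ.* (∏< K g ℕ.* x)) gt≡1 ⟨
  f K ℕ.* ∏< (suc K) g   ∎
... | no t≢K = begin
  ∏< K f ℕ.* f K
    ≡⟨ cong₂ ℕ._*_ (∏-update K t t<K gt≡1 (λ i i<K → f≡g i (ℕP.m<n⇒m<1+n i<K)))
                   (f≡g K ℕP.≤-refl (t≢K ∘ sym)) ⟩
  (f t ℕ.* ∏< K g) ℕ.* g K
    ≡⟨ ℕP.*-assoc (f t) (∏< K g) (g K) ⟩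
  f t ℕ.* ∏< (suc K) g ∎
  where t<K = ℕP.≤∧≢⇒< (ℕP.≤-pred t<1+K) t≢K

zBlock : ℕ → ℕ → ℕ
zBlock i k = i ℕ.^ k ℕ.* k ℕ.!

zfactor : List ℕ → ℕ → ℕ
zfactor μ i = zBlock i (mult i μ)

z≡∏ : ∀ μ → z μ ≡ ∏< (ℕL.sum μ) (zfactor μ ∘ suc)
z≡∏ μ = trans (cong ℕL.product (sym (LP.map-∘ (L.upTo (ℕL.sum μ))))) (product-upTo (zfactor μ ∘ suc) (ℕL.sum μ))

mult-++ : ∀ i xs ys → mult i (xs ++ ys) ≡ mult i xs ℕ.+ mult i ys
mult-++ i xs ys = trans (cong length (LP.filter-++ (ℕ._≟ i) xs ys)) (LP.length-++ (L.filter (ℕ._≟ i) xs))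

mult-replicate : ∀ m b → mult b (replicate m b) ≡ m
mult-replicate m b = trans (cong length (LP.filter-all (ℕ._≟ b) (AllP.replicate⁺ m refl))) (LP.length-replicate m)

mult-absent : ∀ i xs → All (_≢ i) xs → mult i xs ≡ 0
mult-absent i xs xs≢i = cong length (LP.filter-none (ℕ._≟ i) xs≢i)

parts≤sum : ∀ μ → All (_≤ ℕL.sum μ) μ
parts≤sum []      = []
parts≤sum (x ∷ μ) = ℕP.m≤m+n x (ℕL.sum μ) ∷ All.map (λ y≤ → ℕP.≤-trans y≤ (ℕP.m≤n+m (ℕL.sum μ) x)) (parts≤sum μ)

z-replicate : ∀ m b ν → All (_≤ b) ν → z (replicate m (suc b) ++ ν) ≡ zBlock (suc b) m ℕ.* z ν
z-replicate zero    b ν ν≤b = sym (ℕP.+-identityʳ (z ν))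
z-replicate (suc m) b ν ν≤b = begin
  z μ
    ≡⟨ z≡∏ μ ⟩
  ∏< K (zfactor μ ∘ suc)
    ≡⟨ ∏-update K b b<K (cong (zBlock (suc b)) absent) elsewhere ⟩
  zfactor μ (suc b) ℕ.* ∏< K (zfactor ν ∘ suc)
    ≡⟨ cong₂ ℕ._*_ (cong (zBlock (suc b)) here) (∏-truncate _ sum≤K beyond) ⟩
  zBlock (suc b) (suc m) ℕ.* ∏< (ℕL.sum ν) (zfactor ν ∘ suc)
    ≡⟨ cong (zBlock (suc b) (suc m) ℕ.*_) (z≡∏ ν) ⟨
  zBlock (suc b) (suc m) ℕ.* z ν ∎
  where
  bs = replicate (suc m) (suc b)
  μ = bs ++ ν
  K = ℕL.sum μ
  b<K : b < K
  b<K = s≤s (ℕP.m≤m+n b _)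
  absent : mult (suc b) ν ≡ 0
  absent = mult-absent (suc b) ν (All.map (λ x≤b → ℕP.<⇒≢ (s≤s x≤b)) ν≤b)
  here : mult (suc b) μ ≡ suc m
  here = begin
    mult (suc b) μ                     ≡⟨ mult-++ (suc b) bs ν ⟩
    mult (suc b) bs ℕ.+ mult (suc b) ν ≡⟨ cong₂ ℕ._+_ (mult-replicate (suc m) (suc b)) absent ⟩
    suc m ℕ.+ 0                        ≡⟨ ℕP.+-identityʳ (suc m) ⟩
    suc m                              ∎
  elsewhere : ∀ i → i < K → i ≢ b → zfactor μ (suc i) ≡ zfactor ν (suc i)
  elsewhere i _ i≢b = cong (zBlock (suc i)) (trans (mult-++ (suc i) bs ν) (cong (ℕ._+ mult (suc i) ν) not-in-bs))
    where
    not-in-bs : mult (suc i) bs ≡ 0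
    not-in-bs = mult-absent (suc i) bs (AllP.replicate⁺ (suc m) (i≢b ∘ sym ∘ ℕP.suc-injective))
  sum≤K : ℕL.sum ν ≤ K
  sum≤K = ℕP.≤-trans (ℕP.m≤n+m (ℕL.sum ν) (ℕL.sum bs)) (ℕP.≤-reflexive (sym (ℕLP.sum-++ bs ν)))
  beyond : ∀ i → ℕL.sum ν ≤ i → zfactor ν (suc i) ≡ 1
  beyond i sum≤i = cong (zBlock (suc i)) (mult-absent (suc i) ν (All.map below (parts≤sum ν)))
    where
    below : ∀ {x} → x ≤ ℕL.sum ν → x ≢ suc i
    below x≤ = ℕP.<⇒≢ (s≤s (ℕP.≤-trans x≤ sum≤i))

recip-zBlock-suc : ∀ b m → recip (zBlock (suc b) (suc m)) ≡ recip (suc b) * recip (suc m) * recip (zBlock (suc b) m)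
recip-zBlock-suc b m = begin
  recip ((B ℕ.* B ℕ.^ m) ℕ.* (suc m ℕ.* m ℕ.!))
    ≡⟨ recip-* (B ℕ.* B ℕ.^ m) (suc m ℕ.* m ℕ.!) ⟩
  recip (B ℕ.* B ℕ.^ m) * recip (suc m ℕ.* m ℕ.!)
    ≡⟨ cong₂ _*_ (recip-* B (B ℕ.^ m)) (recip-* (suc m) (m ℕ.!)) ⟩
  (recip B * recip (B ℕ.^ m)) * (recip (suc m) * recip (m ℕ.!))
    ≡⟨ ℚ*.interchange (recip B) (recip (B ℕ.^ m)) (recip (suc m)) (recip (m ℕ.!)) ⟩
  (recip B * recip (suc m)) * (recip (B ℕ.^ m) * recip (m ℕ.!))
    ≡⟨ cong (recip B * recip (suc m) *_) (recip-* (B ℕ.^ m) (m ℕ.!)) ⟨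
  recip B * recip (suc m) * recip (zBlock B m) ∎
  where
  B = suc b

length-replicate-++ : ∀ {A : Set} m (x : A) xs → length (replicate m x ++ xs) ≡ m ℕ.+ length xs
length-replicate-++ m x xs = trans (LP.length-++ (replicate m x)) (cong (ℕ._+ length xs) (LP.length-replicate m))

^ℚ-+ : ∀ x a c → x ^ℚ (a ℕ.+ c) ≡ x ^ℚ a * x ^ℚ c
^ℚ-+ x zero    c = sym (ℚP.*-identityˡ _)
^ℚ-+ x (suc a) c = trans (cong (x *_) (^ℚ-+ x a c)) (sym (ℚP.*-assoc x _ _))

-- Weighted partition sums

module Weights (X : ℚ) where

  weight : List ℕ → ℚ
  weight μ = X ^ℚ length μ * recip (z μ)

  weightSum : ℕ → ℕ → ℚ
  weightSum = partSum weight

  blockWeight : ℕ → ℕ → ℚ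
  blockWeight b m = X ^ℚ m * recip (zBlock b m)

  weight-replicate : ∀ m b ν → All (_≤ b) ν → weight (replicate m (suc b) ++ ν) ≡ blockWeight (suc b) m * weight ν
  weight-replicate m b ν ν≤b = begin
    weight (replicate m B ++ ν)
      ≡⟨ cong₂ (λ l t → X ^ℚ l * recip t) (length-replicate-++ m B ν) (z-replicate m b ν ν≤b) ⟩
    X ^ℚ (m ℕ.+ length ν) * recip (zBlock B m ℕ.* z ν)
      ≡⟨ cong₂ _*_ (^ℚ-+ X m (length ν)) (recip-* (zBlock B m) (z ν)) ⟩
    (X ^ℚ m * X ^ℚ length ν) * (recip (zBlock B m) * recip (z ν))
      ≡⟨ ℚ*.interchange (X ^ℚ m) (X ^ℚ length ν) (recip (zBlock B m)) (recip (z ν)) ⟩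
    blockWeight B m * weight ν ∎
    where B = suc b

  weightSum-rec : ∀ b N →
    weightSum N (suc b) ≡ ∑[ m < suc N ] guard (m ℕ.* suc b) N (blockWeight (suc b) m * weightSum (N ∸ m ℕ.* suc b) b)
  weightSum-rec b N = trans (partSum-replicate weight _ b N (λ m ν → weight-replicate m b ν))
    (∑-cong (suc N) (λ m _ → cong (guard (m ℕ.* B) N)
                                  (sym (partSum-distribˡ (blockWeight B m) weight (N ∸ m ℕ.* B) b))))
    where B = suc b

  weightSum-rec-shifted : ∀ a c b N M → N < a ℕ.+ M →
    ∑[ m < M ] guard (a ℕ.+ m ℕ.* suc b) N (c * (blockWeight (suc b) m * weightSum (N ∸ a ∸ m ℕ.* suc b) b)) ≡
    guard a N (c * weightSum (N ∸ a) (suc b))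
  weightSum-rec-shifted a c b N M N<a+M = by-cases (a ℕ.≤? N)
    where
    B = suc b
    term : ℕ → ℚ
    term m = blockWeight B m * weightSum (N ∸ a ∸ m ℕ.* B) b
    by-cases : Dec (a ≤ N) → ∑[ m < M ] guard (a ℕ.+ m ℕ.* B) N (c * term m) ≡ guard a N (c * weightSum (N ∸ a) B)
    by-cases (no  a≰N) = trans (∑-zero M (λ m _ → guard-no _ (a≰N ∘ ℕP.m+n≤o⇒m≤o a))) (sym (guard-no _ a≰N))
    by-cases (yes a≤N) = begin
      ∑[ m < M ] guard (a ℕ.+ m ℕ.* B) N (c * term m)
        ≡⟨ ∑-cong M (λ m _ → trans (guard-shift a (m ℕ.* B) N _ a≤N) (guard-* (m ℕ.* B) (N ∸ a) c (term m))) ⟩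
      ∑[ m < M ] (c * guard (m ℕ.* B) (N ∸ a) (term m))
        ≡⟨ ∑-distribˡ M c _ ⟨
      c * ∑[ m < M ] guard (m ℕ.* B) (N ∸ a) (term m)
        ≡⟨ cong (c *_) (∑-truncate _ N∸a<M beyond) ⟩
      c * ∑[ m < suc (N ∸ a) ] guard (m ℕ.* B) (N ∸ a) (term m)
        ≡⟨ cong (c *_) (weightSum-rec b (N ∸ a)) ⟨
      c * weightSum (N ∸ a) B
        ≡⟨ guard-yes _ a≤N ⟨
      guard a N (c * weightSum (N ∸ a) B) ∎
      where
      N∸a<M : suc (N ∸ a) ≤ M
      N∸a<M = ℕP.+-cancelˡ-≤ a (suc (N ∸ a)) M (subst (_≤ a ℕ.+ M) split N<a+M)
        where
        split : suc N ≡ a ℕ.+ suc (N ∸ a)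
        split = trans (cong suc (sym (ℕP.m+[n∸m]≡n a≤N))) (sym (ℕP.+-suc a (N ∸ a)))
      beyond : ∀ m → suc (N ∸ a) ≤ m → guard (m ℕ.* B) (N ∸ a) (term m) ≡ 0ℚ
      beyond m N∸a<m = guard-no _ (ℕP.<⇒≱ (ℕP.<-≤-trans N∸a<m (ℕP.m≤m*n m B)))

  module Marked (φ : ℕ → ℚ) where

    markedWeight : List ℕ → ℚ
    markedWeight μ = (X ^ℚ (length μ ∸ 1) * recip (z μ)) * Σℚ (map φ μ)

    markedSum : ℕ → ℕ → ℚ
    markedSum = partSum markedWeight

    markedBlock : ℕ → ℕ → ℚ
    markedBlock b zero    = 0ℚ
    markedBlock b (suc m) = φ b * recip b * blockWeight b m

    Σφ-replicate : ∀ m b ν → Σℚ (map φ (replicate m b ++ ν)) ≡ ⟦ m ⟧ * φ b + Σℚ (map φ ν)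
    Σφ-replicate zero    b ν = sym (trans (cong (_+ Σℚ (map φ ν)) (ℚP.*-zeroˡ (φ b))) (ℚP.+-identityˡ _))
    Σφ-replicate (suc m) b ν = begin
      φ b + Σℚ (map φ (replicate m b ++ ν)) ≡⟨ cong (φ b +_) (Σφ-replicate m b ν) ⟩
      φ b + (⟦ m ⟧ * φ b + Σℚ (map φ ν))    ≡⟨ regroup (φ b) ⟦ m ⟧ (Σℚ (map φ ν)) ⟩
      (1ℚ + ⟦ m ⟧) * φ b + Σℚ (map φ ν)     ≡⟨ cong (λ t → t * φ b + Σℚ (map φ ν)) (⟦⟧-suc m) ⟨
      ⟦ suc m ⟧ * φ b + Σℚ (map φ ν)        ∎
      where
      regroup : ∀ p k s → p + (k * p + s) ≡ (1ℚ + k) * p + s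
      regroup = solve-∀ ℚ-ring

    -- For ν = [] only the empty sum makes this true: length ν ∸ 1 truncates to 0.
    ^length*Σφ : ∀ ν → X ^ℚ length ν * Σℚ (map φ ν) ≡ X * (X ^ℚ (length ν ∸ 1) * Σℚ (map φ ν))
    ^length*Σφ []      = begin
      1ℚ * 0ℚ       ≡⟨ ℚP.*-zeroʳ 1ℚ ⟩
      0ℚ            ≡⟨ ℚP.*-zeroʳ X ⟨
      X * 0ℚ        ≡⟨ cong (X *_) (ℚP.*-zeroʳ 1ℚ) ⟨
      X * (1ℚ * 0ℚ) ∎
    ^length*Σφ (x ∷ ν) = ℚP.*-assoc X (X ^ℚ length ν) _

    markedWeight-replicate : ∀ m b ν → All (_≤ b) ν →
      markedWeight (replicate m (suc b) ++ ν) ≡ markedBlock (suc b) m * weight ν + blockWeight (suc b) m * markedWeight ν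
    markedWeight-replicate zero    b ν _ =
      sym (trans (cong₂ _+_ (ℚP.*-zeroˡ (weight ν)) (ℚP.*-identityˡ (markedWeight ν)))
                 (ℚP.+-identityˡ (markedWeight ν)))
    markedWeight-replicate (suc m) b ν ν≤b = begin
      markedWeight (replicate (suc m) B ++ ν)
        ≡⟨ cong₂ _*_ (cong₂ (λ l t → X ^ℚ l * recip t) (length-replicate-++ m B ν)
                            (z-replicate (suc m) b ν ν≤b))
                     (Σφ-replicate (suc m) B ν) ⟩
      (X ^ℚ (m ℕ.+ length ν) * recip (zBlock B (suc m) ℕ.* z ν)) * (⟦ suc m ⟧ * φ B + Σν)
        ≡⟨ cong₂ (λ p r → (p * r) * (⟦ suc m ⟧ * φ B + Σν)) (^ℚ-+ X m (length ν))
                 (trans (recip-* (zBlock B (suc m)) (z ν)) (cong (_* rz) (recip-zBlock-suc b m))) ⟩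
      (P * Q * (R * s * Rm * rz)) * (⟦ suc m ⟧ * φ B + Σν)
        ≡⟨ expand P Q R s Rm rz ⟦ suc m ⟧ (φ B) Σν ⟩
      (⟦ suc m ⟧ * s) * (φ B * R * (P * Rm) * (Q * rz)) + (P * (R * s * Rm)) * (rz * (Q * Σν))
        ≡⟨ cong₂ (λ u v → u * (φ B * R * (P * Rm) * (Q * rz)) + (P * (R * s * Rm)) * (rz * v))
                 (⟦⟧*recip (suc m)) (^length*Σφ ν) ⟩
      1ℚ * (φ B * R * (P * Rm) * (Q * rz)) + (P * (R * s * Rm)) * (rz * (X * (Q′ * Σν)))
        ≡⟨ regroup (φ B) R P Rm Q rz s X Q′ Σν ⟩
      markedBlock B (suc m) * weight ν + (X * P) * (R * s * Rm) * markedWeight ν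
        ≡⟨ cong (λ t → markedBlock B (suc m) * weight ν + (X * P) * t * markedWeight ν) (recip-zBlock-suc b m) ⟨
      markedBlock B (suc m) * weight ν + blockWeight B (suc m) * markedWeight ν ∎
      where
      B  = suc b
      P  = X ^ℚ m
      Q  = X ^ℚ length ν
      Q′ = X ^ℚ (length ν ∸ 1)
      R  = recip B
      s  = recip (suc m)
      Rm = recip (zBlock B m)
      rz = recip (z ν)
      Σν = Σℚ (map φ ν)
      expand : ∀ p q r s rm rz k f σ →
        (p * q * (r * s * rm * rz)) * (k * f + σ) ≡
        (k * s) * (f * r * (p * rm) * (q * rz)) + (p * (r * s * rm)) * (rz * (q * σ))
      expand = solve-∀ ℚ-ring
      regroup : ∀ f r p rm q rz s x q′ σ →
        1ℚ * (f * r * (p * rm) * (q * rz)) + (p * (r * s * rm)) * (rz * (x * (q′ * σ))) ≡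
        f * r * (p * rm) * (q * rz) + (x * p) * (r * s * rm) * ((q′ * rz) * σ)
      regroup = solve-∀ ℚ-ring

    markedSum-rec : ∀ b N → markedSum N (suc b) ≡
      ∑[ m < suc N ] guard (m ℕ.* suc b) N
        (markedBlock (suc b) m * weightSum (N ∸ m ℕ.* suc b) b + blockWeight (suc b) m * markedSum (N ∸ m ℕ.* suc b) b)
    markedSum-rec b N = trans (partSum-replicate markedWeight _ b N (λ m ν → markedWeight-replicate m b ν))
      (∑-cong (suc N) (λ m _ → cong (guard (m ℕ.* B) N) (split m (N ∸ m ℕ.* B))))
      where
      B = suc b
      split : ∀ m N′ → partSum (λ ν → markedBlock B m * weight ν + blockWeight B m * markedWeight ν) N′ b ≡
                       markedBlock B m * weightSum N′ b + blockWeight B m * markedSum N′ b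
      split m N′ = trans (partSum-distrib-+ _ _ N′ b)
        (sym (cong₂ _+_ (partSum-distribˡ (markedBlock B m) weight N′ b)
                        (partSum-distribˡ (blockWeight B m) markedWeight N′ b)))

    Marking : ℕ → Set
    Marking b = ∀ N → markedSum N b ≡ ∑[ j < b ] guard (suc j) N (φ (suc j) * recip (suc j) * weightSum (N ∸ suc j) b)

    ∑-markedBlock : ∀ b N →
      ∑[ m < suc N ] guard (m ℕ.* suc b) N (markedBlock (suc b) m * weightSum (N ∸ m ℕ.* suc b) b) ≡
                            guard (suc b) N (φ (suc b) * recip (suc b) * weightSum (N ∸ suc b) (suc b))
    ∑-markedBlock b N = begin
      ∑[ m < suc N ] guard (m ℕ.* B) N (markedBlock B m * W (N ∸ m ℕ.* B))
        ≡⟨ ∑-head N _ ⟩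
      guard 0 N (0ℚ * W N) + ∑[ m < N ] guard (B ℕ.+ m ℕ.* B) N (markedBlock B (suc m) * W (N ∸ (B ℕ.+ m ℕ.* B)))
        ≡⟨ cong₂ _+_ first (∑-cong N (λ m _ → cong (guard (B ℕ.+ m ℕ.* B) N) (pull-out m))) ⟩
      0ℚ + ∑[ m < N ] guard (B ℕ.+ m ℕ.* B) N (c * (blockWeight B m * W (N ∸ B ∸ m ℕ.* B)))
        ≡⟨ ℚP.+-identityˡ _ ⟩
      ∑[ m < N ] guard (B ℕ.+ m ℕ.* B) N (c * (blockWeight B m * W (N ∸ B ∸ m ℕ.* B)))
        ≡⟨ weightSum-rec-shifted B c b N N (s≤s (ℕP.m≤n+m N b)) ⟩
      guard B N (c * weightSum (N ∸ B) B) ∎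
      where
      B = suc b
      c = φ B * recip B
      W : ℕ → ℚ
      W k = weightSum k b
      first : guard 0 N (0ℚ * W N) ≡ 0ℚ
      first = trans (guard-yes {k = N} _ z≤n) (ℚP.*-zeroˡ (W N))
      pull-out : ∀ m →
        markedBlock B (suc m) * W (N ∸ (B ℕ.+ m ℕ.* B)) ≡ c * (blockWeight B m * W (N ∸ B ∸ m ℕ.* B))
      pull-out m = trans (cong (λ k → markedBlock B (suc m) * W k) (sym (ℕP.∸-+-assoc N B (m ℕ.* B))))
                         (ℚP.*-assoc c (blockWeight B m) _)

    ∑-blockWeight-markedSum : ∀ b N → Marking b →
      ∑[ m < suc N ] guard (m ℕ.* suc b) N (blockWeight (suc b) m * markedSum (N ∸ m ℕ.* suc b) b) ≡
      ∑[ j < b ] guard (suc j) N (φ (suc j) * recip (suc j) * weightSum (N ∸ suc j) (suc b))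
    ∑-blockWeight-markedSum b N marking-b = begin
      ∑[ m < suc N ] guard (m ℕ.* B) N (blockWeight B m * markedSum (N ∸ m ℕ.* B) b)
        ≡⟨ ∑-cong (suc N) (λ m _ → expand m) ⟩
      ∑[ m < suc N ] ∑< b (H m)
        ≡⟨ ∑-comm (suc N) b H ⟩
      ∑[ j < b ] ∑[ m < suc N ] H m j
        ≡⟨ ∑-cong b (λ j _ → collect j) ⟩
      ∑[ j < b ] guard (suc j) N (c j * weightSum (N ∸ suc j) B) ∎
      where
      B = suc b
      c : ℕ → ℚ
      c j = φ (suc j) * recip (suc j)
      H : ℕ → ℕ → ℚ
      H m j = guard (m ℕ.* B ℕ.+ suc j) N (blockWeight B m * (c j * weightSum (N ∸ m ℕ.* B ∸ suc j) b))
      expand : ∀ m → guard (m ℕ.* B) N (blockWeight B m * markedSum (N ∸ m ℕ.* B) b) ≡ ∑< b (H m)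
      expand m = begin
        guard (m ℕ.* B) N (blockWeight B m * markedSum N′ b)
          ≡⟨ cong (guard (m ℕ.* B) N ∘ (blockWeight B m *_)) (marking-b N′) ⟩
        guard (m ℕ.* B) N (blockWeight B m * ∑[ j < b ] guard (suc j) N′ (t j))
          ≡⟨ cong (guard (m ℕ.* B) N) (∑-distribˡ b (blockWeight B m) _) ⟩
        guard (m ℕ.* B) N (∑[ j < b ] (blockWeight B m * guard (suc j) N′ (t j)))
          ≡⟨ guard-∑ (m ℕ.* B) N b _ ⟩
        ∑[ j < b ] guard (m ℕ.* B) N (blockWeight B m * guard (suc j) N′ (t j))
          ≡⟨ ∑-cong b (λ j _ → cong (guard (m ℕ.* B) N) (guard-* (suc j) N′ (blockWeight B m) (t j))) ⟨
        ∑[ j < b ] guard (m ℕ.* B) N (guard (suc j) N′ (blockWeight B m * t j))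
          ≡⟨ ∑-cong b (λ j _ → guard-guard (m ℕ.* B) (suc j) N _) ⟩
        ∑< b (H m) ∎
        where
        N′ = N ∸ m ℕ.* B
        t : ℕ → ℚ
        t j = c j * weightSum (N′ ∸ suc j) b
      collect : ∀ j → ∑[ m < suc N ] H m j ≡ guard (suc j) N (c j * weightSum (N ∸ suc j) B)
      collect j = trans (∑-cong (suc N) (λ m _ → reorder m))
        (weightSum-rec-shifted (suc j) (c j) b N (suc N) (ℕP.m≤n+m (suc N) (suc j)))
        where
        ∸-swap : ∀ n a c → n ∸ a ∸ c ≡ n ∸ c ∸ a
        ∸-swap n a c = trans (ℕP.∸-+-assoc n a c) (trans (cong (n ∸_) (ℕP.+-comm a c)) (sym (ℕP.∸-+-assoc n c a)))
        reorder : ∀ m →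
          H m j ≡ guard (suc j ℕ.+ m ℕ.* B) N (c j * (blockWeight B m * weightSum (N ∸ suc j ∸ m ℕ.* B) b))
        reorder m = cong₂ (λ k t → guard k N t) (ℕP.+-comm (m ℕ.* B) (suc j))
          (trans (cong (λ k → blockWeight B m * (c j * weightSum k b)) (∸-swap N (m ℕ.* B) (suc j)))
                 (ℚ*.x∙yz≈y∙xz (blockWeight B m) (c j) _))

    marking : ∀ b → Marking b
    marking zero    zero    = refl
    marking zero    (suc n) = partSum-largest markedWeight n 0
    marking (suc b) N = begin
      markedSum N B
        ≡⟨ markedSum-rec b N ⟩
      ∑[ m < suc N ] guard (m ℕ.* B) N (F m + G m)
        ≡⟨ ∑-cong (suc N) (λ m _ → guard-+ (m ℕ.* B) N (F m) (G m)) ⟩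
      ∑[ m < suc N ] (guard (m ℕ.* B) N (F m) + guard (m ℕ.* B) N (G m))
        ≡⟨ ∑-distrib-+ (suc N) _ _ ⟩
      ∑[ m < suc N ] guard (m ℕ.* B) N (F m) + ∑[ m < suc N ] guard (m ℕ.* B) N (G m)
        ≡⟨ cong₂ _+_ (∑-markedBlock b N) (∑-blockWeight-markedSum b N (marking b)) ⟩
      term b + ∑< b term
        ≡⟨ ℚP.+-comm (term b) (∑< b term) ⟩
      ∑< (suc b) term ∎
      where
      B = suc b
      F G : ℕ → ℚ
      F m = markedBlock B m * weightSum (N ∸ m ℕ.* B) b
      G m = blockWeight B m * markedSum (N ∸ m ℕ.* B) b
      term : ℕ → ℚ
      term j = guard (suc j) N (φ (suc j) * recip (suc j) * weightSum (N ∸ suc j) B)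

    marking-diagonal : ∀ N →
      markedSum N N ≡ ∑[ j < N ] (φ (suc j) * recip (suc j) * weightSum (N ∸ suc j) (N ∸ suc j))
    marking-diagonal N = trans (marking N N) (∑-cong N (λ j j<N → begin
      guard (suc j) N (c j * weightSum (N ∸ suc j) N)
        ≡⟨ guard-yes _ j<N ⟩
      c j * weightSum (N ∸ suc j) N
        ≡⟨ cong (c j *_) (partSum-bound weight (N ∸ suc j) (ℕP.m∸n≤m N (suc j)) ℕP.≤-refl) ⟩
      c j * weightSum (N ∸ suc j) (N ∸ suc j) ∎))
      where
      c : ℕ → ℚ
      c j = φ (suc j) * recip (suc j)

  Σℚ-⟦⟧ : ∀ μ → Σℚ (map ⟦_⟧ μ) ≡ ⟦ ℕL.sum μ ⟧
  Σℚ-⟦⟧ []      = refl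
  Σℚ-⟦⟧ (x ∷ μ) = trans (cong (⟦ x ⟧ +_) (Σℚ-⟦⟧ μ)) (sym (⟦⟧-homo-+ x (ℕL.sum μ)))

  X*markedSum-⟦⟧ : ∀ N b → X * Marked.markedSum ⟦_⟧ N b ≡ ⟦ N ⟧ * weightSum N b
  X*markedSum-⟦⟧ N b = begin
    X * markedSum N b                      ≡⟨ partSum-distribˡ X markedWeight N b ⟩
    partSum (λ μ → X * markedWeight μ) N b ≡⟨ partSum-cong N b per-partition ⟩
    partSum (λ μ → ⟦ N ⟧ * weight μ) N b   ≡⟨ partSum-distribˡ ⟦ N ⟧ weight N b ⟨
    ⟦ N ⟧ * weightSum N b                  ∎
    where
    open Marked ⟦_⟧
    per-partition : ∀ μ → Partition N b μ → X * markedWeight μ ≡ ⟦ N ⟧ * weight μ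
    per-partition μ (sum≡N , _) = begin
      X * ((Q′ * recip (z μ)) * Σℚ (map ⟦_⟧ μ))
        ≡⟨ regroup X Q′ (recip (z μ)) _ ⟩
      recip (z μ) * (X * (Q′ * Σℚ (map ⟦_⟧ μ)))
        ≡⟨ cong (recip (z μ) *_) (^length*Σφ μ) ⟨
      recip (z μ) * (X ^ℚ length μ * Σℚ (map ⟦_⟧ μ))
        ≡⟨ cong (λ t → recip (z μ) * (X ^ℚ length μ * t)) (trans (Σℚ-⟦⟧ μ) (cong ⟦_⟧ sum≡N)) ⟩
      recip (z μ) * (X ^ℚ length μ * ⟦ N ⟧)
        ≡⟨ regroup′ (recip (z μ)) (X ^ℚ length μ) ⟦ N ⟧ ⟩
      ⟦ N ⟧ * weight μ ∎
      where
      Q′ = X ^ℚ (length μ ∸ 1)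
      regroup : ∀ x p r s → x * ((p * r) * s) ≡ r * (x * (p * s))
      regroup = solve-∀ ℚ-ring
      regroup′ : ∀ r p n → r * (p * n) ≡ n * (p * r)
      regroup′ = solve-∀ ℚ-ring

  weightSum-diagonal-rec : ∀ N → ⟦ N ⟧ * weightSum N N ≡ X * ∑[ s < N ] weightSum s s
  weightSum-diagonal-rec N = begin
    ⟦ N ⟧ * weightSum N N                                      ≡⟨ X*markedSum-⟦⟧ N N ⟨
    X * Marked.markedSum ⟦_⟧ N N                               ≡⟨ cong (X *_) (Marked.marking-diagonal ⟦_⟧ N) ⟩
    X * ∑[ j < N ] (⟦ suc j ⟧ * recip (suc j) * W (N ∸ suc j)) ≡⟨ cong (X *_) (∑-cong N (λ j _ → cancel j)) ⟩
    X * ∑[ j < N ] W (N ∸ suc j)                               ≡⟨ cong (X *_) (∑-reverse N W) ⟨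
    X * ∑< N W                                                 ∎
    where
    W : ℕ → ℚ
    W s = weightSum s s
    cancel : ∀ j → ⟦ suc j ⟧ * recip (suc j) * W (N ∸ suc j) ≡ W (N ∸ suc j)
    cancel j = trans (cong (_* W (N ∸ suc j)) (⟦⟧*recip (suc j))) (ℚP.*-identityˡ _)

  weightSum≡multichoose : ∀ N → weightSum N N ≡ multichoose X N
  weightSum≡multichoose = <-rec (λ N → weightSum N N ≡ multichoose X N) step
    where
    step : ∀ N → (∀ {s} → s < N → weightSum s s ≡ multichoose X s) → weightSum N N ≡ multichoose X N
    step zero    _  = refl
    step (suc n) IH = ⟦⟧*-cancelˡ (suc n) (begin
      ⟦ suc n ⟧ * weightSum (suc n) (suc n) ≡⟨ weightSum-diagonal-rec (suc n) ⟩
      X * ∑[ s < suc n ] weightSum s s      ≡⟨ cong (X *_) (∑-cong (suc n) (λ s s<N → IH s<N)) ⟩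
      X * ∑< (suc n) (multichoose X)        ≡⟨ multichoose-rec X (suc n) ⟨
      ⟦ suc n ⟧ * multichoose X (suc n)     ∎)

  markedSum-diagonal : ∀ φ n →
    Marked.markedSum φ n n ≡ ∑[ j < n ] (φ (suc j) * recip (suc j) * multichoose X (n ∸ suc j))
  markedSum-diagonal φ n = trans (Marked.marking-diagonal φ n)
    (∑-cong n (λ j _ → cong (φ (suc j) * recip (suc j) *_) (weightSum≡multichoose (n ∸ suc j))))

-- The coefficients c_k

oneS-vanish : ∀ {m} (r : Vec ℕ m) → 0 < V.sum r → oneS r ≡ 0ℚ
oneS-vanish r 0<sum with V.sum r | 0<sum
... | suc _ | _ = refl

module Coefficients {m} (r : Vec ℕ m) (0<|r| : 0 < V.sum r) where

  powerCoeff : ℕ → ℚ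
  powerCoeff i = (invProd⊖1 m ^S i) r

  targetCoeff : ℕ → ℚ
  targetCoeff i = recip (suc i) * powerCoeff (suc i)

  risingWeight/ : ∀ j → risingWeight (suc j) r * recip (suc j) ≡ ∑[ i < suc j ] (⟦ j C i ⟧ * targetCoeff i)
  risingWeight/ j = begin
    risingWeight (suc j) r * recip (suc j)
      ≡⟨ cong (_* recip (suc j)) (risingWeight-binomial m (suc j) r) ⟩
    ∑[ i < suc (suc j) ] (⟦ suc j C i ⟧ * q i) * recip (suc j)
      ≡⟨ cong (_* recip (suc j)) (∑-head (suc j) (λ i → ⟦ suc j C i ⟧ * q i)) ⟩
    (1ℚ * q 0 + S) * recip (suc j)
      ≡⟨ cong (λ t → (1ℚ * t + S) * recip (suc j)) (oneS-vanish r 0<|r|) ⟩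
    (1ℚ * 0ℚ + S) * recip (suc j)
      ≡⟨ cong (_* recip (suc j)) (ℚP.+-identityˡ S) ⟩
    S * recip (suc j)
      ≡⟨ ∑-distribʳ (suc j) (recip (suc j)) _ ⟩
    ∑[ i < suc j ] (⟦ suc j C suc i ⟧ * q (suc i) * recip (suc j))
      ≡⟨ ∑-cong (suc j) (λ i _ → absorb i) ⟩
    ∑[ i < suc j ] (⟦ j C i ⟧ * targetCoeff i) ∎
    where
    q = powerCoeff
    S = ∑[ i < suc j ] (⟦ suc j C suc i ⟧ * q (suc i))
    absorb : ∀ i → ⟦ suc j C suc i ⟧ * q (suc i) * recip (suc j) ≡ ⟦ j C i ⟧ * targetCoeff i
    absorb i = begin
      ⟦ suc j C suc i ⟧ * q (suc i) * recip (suc j) ≡⟨ ℚ*.xy∙z≈xz∙y ⟦ suc j C suc i ⟧ (q (suc i)) (recip (suc j)) ⟩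
      ⟦ suc j C suc i ⟧ * recip (suc j) * q (suc i) ≡⟨ cong (_* q (suc i)) (C-absorbℚ j i) ⟩
      ⟦ j C i ⟧ * recip (suc i) * q (suc i)         ≡⟨ ℚP.*-assoc ⟦ j C i ⟧ (recip (suc i)) (q (suc i)) ⟩
      ⟦ j C i ⟧ * targetCoeff i                     ∎

  -- lhsSum r n X is, by definition, Weights.Marked.markedSum X (λ j → risingWeight j r) n n.
  lhsSum-expansion : ∀ n X →
    lhsSum r (suc n) X ≡ ∑[ i < suc n ] (targetCoeff i * binomℚ ((X + ⟦ suc n ⟧) - 1ℚ) (n ∸ i))
  lhsSum-expansion n X = begin
    lhsSum r N X
      ≡⟨ Weights.markedSum-diagonal X (λ j → risingWeight j r) N ⟩
    ∑[ j < N ] (risingWeight (suc j) r * recip (suc j) * h j)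
      ≡⟨ ∑-cong N (λ j j<N → spread j j<N) ⟩
    ∑[ j < N ] ∑[ i < N ] (⟦ j C i ⟧ * e i * h j)
      ≡⟨ ∑-comm N N (λ j i → ⟦ j C i ⟧ * e i * h j) ⟩
    ∑[ i < N ] ∑[ j < N ] (⟦ j C i ⟧ * e i * h j)
      ≡⟨ ∑-cong N (λ i i<N → collect i (ℕP.≤-pred i<N)) ⟩
    ∑[ i < N ] (e i * binomℚ ((X + ⟦ N ⟧) - 1ℚ) (n ∸ i)) ∎
    where
    N = suc n
    e = targetCoeff
    h : ℕ → ℚ
    h j = multichoose X (n ∸ j)
    spread : ∀ j → j < N → risingWeight (suc j) r * recip (suc j) * h j ≡ ∑[ i < N ] (⟦ j C i ⟧ * e i * h j)
    spread j j<N = begin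
      risingWeight (suc j) r * recip (suc j) * h j ≡⟨ cong (_* h j) (risingWeight/ j) ⟩
      ∑[ i < suc j ] (⟦ j C i ⟧ * e i) * h j       ≡⟨ ∑-distribʳ (suc j) (h j) _ ⟩
      ∑[ i < suc j ] (⟦ j C i ⟧ * e i * h j)       ≡⟨ ∑-truncate _ j<N vanish ⟨
      ∑[ i < N ] (⟦ j C i ⟧ * e i * h j)           ∎
      where
      vanish : ∀ i → suc j ≤ i → ⟦ j C i ⟧ * e i * h j ≡ 0ℚ
      vanish i j<i = begin
        ⟦ j C i ⟧ * e i * h j ≡⟨ cong (λ t → ⟦ t ⟧ * e i * h j) (k>n⇒nCk≡0 j<i) ⟩
        0ℚ * e i * h j        ≡⟨ cong (_* h j) (ℚP.*-zeroˡ (e i)) ⟩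
        0ℚ * h j              ≡⟨ ℚP.*-zeroˡ (h j) ⟩
        0ℚ                    ∎
    collect : ∀ i → i ≤ n → ∑[ j < N ] (⟦ j C i ⟧ * e i * h j) ≡ e i * binomℚ ((X + ⟦ N ⟧) - 1ℚ) (n ∸ i)
    collect i i≤n = begin
      ∑[ j < N ] (⟦ j C i ⟧ * e i * h j)
        ≡⟨ ∑-cong N (λ j _ → ℚ*.xy∙z≈y∙xz ⟦ j C i ⟧ (e i) (h j)) ⟩
      ∑[ j < N ] (e i * (⟦ j C i ⟧ * h j))
        ≡⟨ ∑-distribˡ N (e i) _ ⟨
      e i * C-sum X i n
        ≡⟨ cong (λ k → e i * C-sum X i k) (ℕP.m+[n∸m]≡n i≤n) ⟨
      e i * C-sum X i (i ℕ.+ (n ∸ i))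
        ≡⟨ cong (e i *_) (C-sum≡multichoose X i (n ∸ i)) ⟩
      e i * multichoose (X + ⟦ suc i ⟧) (n ∸ i)
        ≡⟨ cong (e i *_) (multichoose≡binomℚ (X + ⟦ suc i ⟧) (n ∸ i)) ⟩
      e i * binomℚ ((X + ⟦ suc i ⟧ + ⟦ n ∸ i ⟧) - 1ℚ) (n ∸ i)
        ≡⟨ cong (λ y → e i * binomℚ (y - 1ℚ) (n ∸ i)) X+i+1+[n-i] ⟩
      e i * binomℚ ((X + ⟦ N ⟧) - 1ℚ) (n ∸ i) ∎
      where
      X+i+1+[n-i] : X + ⟦ suc i ⟧ + ⟦ n ∸ i ⟧ ≡ X + ⟦ N ⟧
      X+i+1+[n-i] = begin
        X + ⟦ suc i ⟧ + ⟦ n ∸ i ⟧   ≡⟨ ℚP.+-assoc X ⟦ suc i ⟧ ⟦ n ∸ i ⟧ ⟩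
        X + (⟦ suc i ⟧ + ⟦ n ∸ i ⟧) ≡⟨ cong (X +_) (⟦⟧-homo-+ (suc i) (n ∸ i)) ⟨
        X + ⟦ suc (i ℕ.+ (n ∸ i)) ⟧ ≡⟨ cong (λ k → X + ⟦ suc k ⟧) (ℕP.m+[n∸m]≡n i≤n) ⟩
        X + ⟦ N ⟧                   ∎

  IsCoeffs⇒same-polynomial : ∀ n c → IsCoeffs r (suc n) c → ∀ X →
    ∑[ j < suc n ] (c (suc j) * recip (V.sum r) * binomℚ ((X + ⟦ suc n ⟧) - 1ℚ) (n ∸ j)) ≡
    ∑[ j < suc n ] (targetCoeff j * binomℚ ((X + ⟦ suc n ⟧) - 1ℚ) (n ∸ j))
  IsCoeffs⇒same-polynomial n c isCoeffs X = begin
    ∑[ j < suc n ] (c (suc j) * |r|⁻¹ * B j)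
      ≡⟨ ∑-cong (suc n) (λ j _ → ℚ*.xy∙z≈y∙xz (c (suc j)) |r|⁻¹ (B j)) ⟩
    ∑[ j < suc n ] (|r|⁻¹ * (c (suc j) * B j))
      ≡⟨ ∑-distribˡ (suc n) |r|⁻¹ _ ⟨
    |r|⁻¹ * ∑[ j < suc n ] (c (suc j) * B j)
      ≡⟨ cong (|r|⁻¹ *_) (Σℚ-range1 (λ k → c k * binomℚ Y (suc n ∸ k)) (suc n)) ⟨
    rhsSum r (suc n) c X
      ≡⟨ isCoeffs X ⟨
    lhsSum r (suc n) X
      ≡⟨ lhsSum-expansion n X ⟩
    ∑[ j < suc n ] (targetCoeff j * B j) ∎
    where
    |r|⁻¹ = recip (V.sum r)
    Y = (X + ⟦ suc n ⟧) - 1ℚ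
    B : ℕ → ℚ
    B j = binomℚ Y (n ∸ j)

  ⟦⟧*targetCoeff : ∀ i → ⟦ suc i ⟧ * targetCoeff i ≡ powerCoeff (suc i)
  ⟦⟧*targetCoeff i = begin
    ⟦ suc i ⟧ * (recip (suc i) * powerCoeff (suc i)) ≡⟨ ℚP.*-assoc ⟦ suc i ⟧ (recip (suc i)) (powerCoeff (suc i)) ⟨
    (⟦ suc i ⟧ * recip (suc i)) * powerCoeff (suc i) ≡⟨ cong (_* powerCoeff (suc i)) (⟦⟧*recip (suc i)) ⟩
    1ℚ * powerCoeff (suc i)                          ≡⟨ ℚP.*-identityˡ (powerCoeff (suc i)) ⟩
    powerCoeff (suc i)                               ∎

mainTheorem2 : (m n : ℕ) → 1 ≤ m → 1 ≤ n → (r : Vec ℕ m) → 0 < sum r →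
    (c : ℕ → ℚ) → IsCoeffs r n c →
    (k : ℕ) → 1 ≤ k → k ≤ n →
      (c k * recip (sum r) ≡ targetSeries m k r)
      × (∃ λ (N : ℕ) → ⟦ k ⟧ * (c k * recip (sum r)) ≡ ⟦ N ⟧)
mainTheorem2 m (suc n) _ _ r 0<|r| c isCoeffs (suc i) _ k≤n =
  coefficient , (N , trans (cong (⟦ suc i ⟧ *_) coefficient) N-witness)
  where
  open Coefficients r 0<|r|
  coefficient : c (suc i) * recip (sum r) ≡ targetCoeff i
  coefficient = binomℚ-shifted-basis-unique (suc n) (λ j → c (suc j) * recip (sum r)) targetCoeff
    (IsCoeffs⇒same-polynomial n c isCoeffs) i k≤n
  N = proj₁ (ℕ-valued-invProd⊖1^S m (suc i) r)
  N-witness : ⟦ suc i ⟧ * targetCoeff i ≡ ⟦ N ⟧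
  N-witness = trans (⟦⟧*targetCoeff i) (proj₂ (ℕ-valued-invProd⊖1^S m (suc i) r))
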